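{- Let $G=(U,V,E)$ be a bipartite (multi)graph with $|U|=|V|=n$ in which every edge is colored red or blue. The linear system in $x\in\mathbb{R}^E$ $\sum_{e\in\delta(w)}x_e=1$ for all $w\in U\cup V$; $\sum_{e\in E_L}x_e\ge 1$ for all $L\in\mathcal{L}_{\mathrm{all}}(G)$; $x_e\ge0$ for all $e\in E$, is feasible if and only if $G$ has a perfect matching with an odd number of red edges.
   Context: An edge is written $(u,v,c)$ with $u\in U$, $v\in V$, color $c\in\{\text{red},\text{blue}\}$; $\delta(w)$ is the set of edges incident to $w$. $\mathcal{L}_{\mathrm{all}}(G)$ is the set of labelings $L:U\cup V\to\{0,1\}$ with $|L^{ -1}(1)|\equiv n\pmod 2$, and for such $L$, $E_L:=\{(u,v,c)\in E: L(u)=L(v),\ c=\text{blue}\}\cup\{(u,v,c)\in E: L(u)\ne L(v),\ c=\text{red}\}$.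
   Formalization: The unknown vector x of the linear system has rational entries, ranging over ℚ^E instead of $\mathbb{R}^E$. -}

module Defs where

open import Data.Nat using (ℕ; zero; suc; _%_)
open import Data.Fin using (Fin; zero; suc; _≟_)
open import Data.Bool using (Bool; true; false; if_then_else_; _∧_; _∨_; not)
open import Data.Rational using (ℚ; 0ℚ; 1ℚ; _+_; _≤_)
open import Data.Product using (Σ; _×_)
open import Relation.Nullary.Decidable using (⌊_⌋)
open import Relation.Binary.PropositionalEquality using (_≡_)

data Color : Set where
  red blue : Color

isRed : Color → Bool
isRed red = true
isRed blue = false

isBlue : Color → Bool
isBlue c = not (isRed c)

-- A bipartite multigraph with U = V = Fin n and m edges indexed by Fin m;
-- edge e goes from uE e ∈ U to vE e ∈ V and has color col e.
record BipGraph (n : ℕ) : Set where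
  field
    m   : ℕ
    uE  : Fin m → Fin n
    vE  : Fin m → Fin n
    col : Fin m → Color
open BipGraph public

sumQ : (k : ℕ) → (Fin k → ℚ) → ℚ
sumQ zero f = 0ℚ
sumQ (suc k) f = f zero + sumQ k (λ i → f (suc i))

count : (k : ℕ) → (Fin k → Bool) → ℕ
count zero p = zero
count (suc k) p = (if p zero then 1 else 0) Data.Nat.+ count k (λ i → p (suc i))

sumOver : ∀ {n} (G : BipGraph n) → (Fin (m G) → Bool) → (Fin (m G) → ℚ) → ℚ
sumOver G p x = sumQ (m G) (λ e → if p e then x e else 0ℚ)

incU : ∀ {n} (G : BipGraph n) → Fin n → Fin (m G) → Bool
incU G u e = ⌊ uE G e ≟ u ⌋

incV : ∀ {n} (G : BipGraph n) → Fin n → Fin (m G) → Bool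
incV G v e = ⌊ vE G e ≟ v ⌋

beq : Bool → Bool → Bool
beq true b = b
beq false b = not b

-- A labeling L : U ∪ V → {0,1}, given as its restrictions LU, LV (true = 1).
-- L ∈ 𝓛_all(G) iff |L⁻¹(1)| ≡ n (mod 2).
InLall : (n : ℕ) → (Fin n → Bool) → (Fin n → Bool) → Set
InLall n LU LV = (count n LU Data.Nat.+ count n LV) % 2 ≡ n % 2

inEL : ∀ {n} (G : BipGraph n) → (Fin n → Bool) → (Fin n → Bool) → Fin (m G) → Bool
inEL G LU LV e =
  (beq (LU (uE G e)) (LV (vE G e)) ∧ isBlue (col G e))
  ∨ (not (beq (LU (uE G e)) (LV (vE G e))) ∧ isRed (col G e))

Feasible : ∀ {n} → BipGraph n → Set
Feasible {n} G = Σ (Fin (m G) → ℚ) λ x →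
    ((u : Fin n) → sumOver G (incU G u) x ≡ 1ℚ)
  × ((v : Fin n) → sumOver G (incV G v) x ≡ 1ℚ)
  × ((LU LV : Fin n → Bool) → InLall n LU LV → 1ℚ ≤ sumOver G (inEL G LU LV) x)
  × ((e : Fin (m G)) → 0ℚ ≤ x e)

IsPerfectMatching : ∀ {n} (G : BipGraph n) → (Fin (m G) → Bool) → Set
IsPerfectMatching {n} G M =
    ((u : Fin n) → count (m G) (λ e → M e ∧ incU G u e) ≡ 1)
  × ((v : Fin n) → count (m G) (λ e → M e ∧ incV G v e) ≡ 1)

HasOddRedPM : ∀ {n} → BipGraph n → Set
HasOddRedPM G = Σ (Fin (m G) → Bool) λ M →
  IsPerfectMatching G M × (count (m G) (λ e → M e ∧ isRed (col G e)) % 2 ≡ 1)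

-- (⇐) The indicator vector x of a perfect matching M satisfies the degree constraints, and for
-- L ∈ 𝓛_all the parity of |M ∩ E_L| is that of the number of red edges of M: summing
-- 1 + L(u) + L(v) + red(e) over the edges of M counts every vertex once.  So if M is odd, every
-- E_L contains an edge of M and Σ_{E_L} x ≥ 1.
-- (⇒) A feasible x is a fractional perfect matching; cancelling alternating cycles of fractional
-- edges shrinks its support down to a perfect matching M₀ inside the support of x.  If M₀ is
-- even, contract it: each support edge e becomes an arc from its U-end to the M₀-partner of its
-- V-end, and x becomes a circulation on these arcs.  Eliminating vertices one at a time, each
-- pair of arcs through a vertex being replaced by a shortcut with proportional flow, shows that
-- a circulation with Z₂-labelled arcs has either a potential for the labels or an odd closed
-- walk.  An odd closed walk shortens to a simple one, i.e. an M₀-alternating cycle whose switch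
-- is an odd perfect matching; a potential yields an L ∈ 𝓛_all with E_L disjoint from the
-- support of x, violating Σ_{E_L} x ≥ 1.

module Submission where

open import Algebra.Bundles using (CommutativeRing)
import Algebra.Properties.CommutativeMonoid.Sum as CommutativeMonoidSum
import Algebra.Properties.CommutativeSemigroup as CommutativeSemigroupProperties
import Algebra.Properties.Group as GroupProperties
open import Data.Bool using (Bool; true; false; not; _∧_; _xor_; if_then_else_)
import Data.Bool.Properties as Bool
open import Data.Bool.Properties
  using (xor-∧-commutativeRing; ¬-not; not-involutive; not-distribˡ-xor; ∧-zeroʳ; xor-assoc; xor-comm; xor-same; xor-identityʳ)
open import Data.Bool.Solver using (module xor-∧-Solver)
open import Data.Empty using (⊥; ⊥-elim)
open import Data.Fin using (Fin; zero; suc; _≟_; toℕ; fromℕ<; punchOut)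
open import Data.Fin.Permutation using (permutation)
open import Data.Fin.Properties
  using (suc-injective; any?; pigeonhole; punchOut-injective; injective⇒≤; toℕ<n; toℕ-fromℕ<; toℕ-injective)
open import Data.List using (List; []; _∷_; _++_; _∷ʳ_; map; filter; allFin; cartesianProductWith)
open import Data.List.Membership.Propositional using (_∈_; _∉_)
open import Data.List.Membership.Propositional.Properties
  using (∈-++⁻; ∈-map⁺; ∈-filter⁺; ∈-allFin; ∈-cartesianProductWith⁺; ∈-cartesianProductWith⁻)
open import Data.List.Relation.Unary.All using (All; []; _∷_)
import Data.List.Relation.Unary.All as All
import Data.List.Relation.Unary.All.Properties as All
open import Data.List.Relation.Unary.All.Properties using (¬Any⇒All¬; All¬⇒¬Any)
open import Data.List.Relation.Unary.Any using (here; there)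
open import Data.List.Relation.Unary.Unique.Propositional using (Unique; []; _∷_)
import Data.List.Relation.Unary.Unique.Propositional.Properties as Unique
open import Data.Maybe using (Maybe; just; nothing; maybe; maybe′)
open import Data.Nat as ℕ using (ℕ; zero; suc; _+_; _%_; z≤n; s≤s)
open import Data.Nat.DivMod using ([m+n]%n≡m%n)
open import Data.Nat.GeneralisedArithmetic using (iterate)
import Data.Nat.Induction as ℕ
import Data.Nat.Properties as ℕ
open import Data.Product using (Σ; ∃; ∃₂; _×_; _,_; proj₁; proj₂)
open import Data.Rational
  using (ℚ; 0ℚ; 1ℚ; _*_; -_; _-_; _÷_; 1/_; _≤_; _<_; positive; nonNegative; NonZero)
  renaming (_+_ to _+ℚ_)
import Data.Rational.Properties as ℚ
open import Data.Rational.Solver using (module +-*-Solver)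
open import Data.Sum using (_⊎_; inj₁; inj₂)
import Data.Sum as Sum
open import Function using (_∘_)
open import Induction.WellFounded using (Acc; acc)
open import Relation.Binary.Bundles using (DecTotalOrder)
open import Relation.Binary.PropositionalEquality
  using (_≡_; _≢_; refl; sym; trans; cong; cong₂; subst; subst₂; module ≡-Reasoning)
open import Relation.Nullary using (¬_; Dec; yes; no; contradiction)
open import Relation.Nullary.Decidable using (⌊_⌋; _×-dec_; ¬?; dec-true; dec-false; isYes≗does; ⌊⌋-map′)
open import Data.List.Extrema (DecTotalOrder.totalOrder ℚ.≤-decTotalOrder) using (argmin; argmin-all; f[argmin]≤f[xs])
open import Defs

module ℚ+ = CommutativeSemigroupProperties (CommutativeRing.+-commutativeSemigroup ℚ.+-*-commutativeRing)
module ℚ* = CommutativeSemigroupProperties (CommutativeRing.*-commutativeSemigroup ℚ.+-*-commutativeRing)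
module ℚ-group = GroupProperties ℚ.+-0-group
module Xor = CommutativeMonoidSum (CommutativeRing.+-commutativeMonoid xor-∧-commutativeRing)
open CommutativeSemigroupProperties (CommutativeRing.+-commutativeSemigroup xor-∧-commutativeRing) using () renaming (interchange to xor-interchange)

⌊⌋-true : ∀ {a} {A : Set a} (d : Dec A) → A → ⌊ d ⌋ ≡ true
⌊⌋-true d x = trans (isYes≗does d) (dec-true d x)

⌊⌋-false : ∀ {a} {A : Set a} (d : Dec A) → ¬ A → ⌊ d ⌋ ≡ false
⌊⌋-false d ¬x = trans (isYes≗does d) (dec-false d ¬x)

⌊⌋-true⁻ : ∀ {a} {A : Set a} (d : Dec A) → ⌊ d ⌋ ≡ true → A
⌊⌋-true⁻ (yes x) _  = x
⌊⌋-true⁻ (no _)  ()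

⌊⌋-cong : ∀ {a b} {A : Set a} {B : Set b} (d : Dec A) (d′ : Dec B) → (A → B) → (B → A) → ⌊ d ⌋ ≡ ⌊ d′ ⌋
⌊⌋-cong (yes _) (yes _) _ _ = refl
⌊⌋-cong (no _)  (no _)  _ _ = refl
⌊⌋-cong (yes a) (no ¬b) f _ = contradiction (f a) ¬b
⌊⌋-cong (no ¬a) (yes b) _ g = contradiction (g b) ¬a

⌊suc≟suc⌋ : ∀ {k} (i j : Fin k) → ⌊ suc i ≟ suc j ⌋ ≡ ⌊ i ≟ j ⌋
⌊suc≟suc⌋ i j = ⌊⌋-map′ (cong suc) suc-injective (i ≟ j)

⌊≟⌋-sym : ∀ {k} (i j : Fin k) → ⌊ i ≟ j ⌋ ≡ ⌊ j ≟ i ⌋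
⌊≟⌋-sym i j = ⌊⌋-cong (i ≟ j) (j ≟ i) sym sym

∧-true⁻ : ∀ {a b} → a ∧ b ≡ true → a ≡ true × b ≡ true
∧-true⁻ {true} {true} _ = refl , refl

xor-cancelˡ : ∀ a b → a xor (a xor b) ≡ b
xor-cancelˡ true  b = not-involutive b
xor-cancelˡ false b = refl

xor-cancelʳ : ∀ a b → (a xor b) xor b ≡ a
xor-cancelʳ a b = trans (xor-assoc a b b) (trans (cong (a xor_) (xor-same b)) (xor-identityʳ a))

xor-solveˡ : ∀ {a b c} → a xor b ≡ c → a ≡ c xor b
xor-solveˡ {a} {b} eq = trans (sym (xor-cancelʳ a b)) (cong (_xor b) eq)

xor-through : ∀ x x₀ h w w₀ w′ → x xor h ≡ w xor w′ → x₀ xor h ≡ w₀ xor w′ → x xor (x₀ xor w₀) ≡ w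
xor-through x x₀ h w w₀ w′ eq eq₀ =
  trans (cong₂ (λ a b → a xor (b xor w₀)) (xor-solveˡ {x} {h} eq) (xor-solveˡ {x₀} {h} eq₀))
        (solve 4 (λ h w w₀ w′ → ((w :+ w′) :+ h) :+ (((w₀ :+ w′) :+ h) :+ w₀) := w) refl h w w₀ w′)
  where open xor-∧-Solver

xor-across : ∀ x₀ h w₀ w′ → x₀ xor h ≡ w₀ xor w′ → (x₀ xor w₀) xor h ≡ w′
xor-across x₀ h w₀ w′ eq₀ =
  trans (cong (λ a → (a xor w₀) xor h) (xor-solveˡ {x₀} {h} eq₀))
        (solve 3 (λ h w₀ w′ → (((w₀ :+ w′) :+ h) :+ w₀) :+ h := w′) refl h w₀ w′)
  where open xor-∧-Solver

isOdd : ℕ → Bool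
isOdd zero = false
isOdd (suc k) = not (isOdd k)

isOdd-+ : ∀ a b → isOdd (a + b) ≡ isOdd a xor isOdd b
isOdd-+ zero b = refl
isOdd-+ (suc a) b = trans (cong not (isOdd-+ a b)) (not-distribˡ-xor (isOdd a) (isOdd b))

%2≡isOdd : ∀ k → k % 2 ≡ (if isOdd k then 1 else 0)
%2≡isOdd zero = refl
%2≡isOdd (suc zero) = refl
%2≡isOdd (suc (suc k)) = begin
  (2 + k) % 2  ≡⟨ cong (_% 2) (ℕ.+-comm 2 k) ⟩
  (k + 2) % 2  ≡⟨ [m+n]%n≡m%n k 2 ⟩
  k % 2                                    ≡⟨ %2≡isOdd k ⟩
  (if isOdd k then 1 else 0)               ≡⟨ cong (λ b → if b then 1 else 0) (not-involutive (isOdd k)) ⟨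
  (if not (not (isOdd k)) then 1 else 0)   ∎
  where open ≡-Reasoning

%2≡⇒isOdd≡ : ∀ a b → a % 2 ≡ b % 2 → isOdd a ≡ isOdd b
%2≡⇒isOdd≡ a b eq with isOdd a | isOdd b | trans (sym (%2≡isOdd a)) (trans eq (%2≡isOdd b))
... | false | false | _  = refl
... | true  | true  | _  = refl
... | false | true  | ()
... | true  | false | ()

isOdd≡⇒%2≡ : ∀ a b → isOdd a ≡ isOdd b → a % 2 ≡ b % 2
isOdd≡⇒%2≡ a b eq = trans (%2≡isOdd a) (trans (cong (λ c → if c then 1 else 0) eq) (sym (%2≡isOdd b)))

⨁ : ∀ {k} → (Fin k → Bool) → Bool
⨁ = Xor.sum

⨁-true : ∀ k → ⨁ {k} (λ _ → true) ≡ isOdd k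
⨁-true zero = refl
⨁-true (suc k) = cong not (⨁-true k)

⨁-true⇒∃ : ∀ {k} (p : Fin k → Bool) → ⨁ p ≡ true → ∃ λ i → p i ≡ true
⨁-true⇒∃ {suc k} p eq with p zero in p₀
... | true  = zero , p₀
... | false with ⨁-true⇒∃ (λ i → p (suc i)) eq
...   | i , pᵢ = suc i , pᵢ

⨁-pick : ∀ {k} (j : Fin k) (g : Fin k → Bool) → ⨁ (λ i → ⌊ i ≟ j ⌋ ∧ g i) ≡ g j
⨁-pick {suc k} zero g = trans (cong (g zero xor_) (Xor.sum-replicate-zero k)) (xor-identityʳ (g zero))
⨁-pick {suc k} (suc j) g =
  trans (Xor.sum-cong-≗ (λ i → cong (_∧ g (suc i)) (⌊suc≟suc⌋ i j))) (⨁-pick j (λ i → g (suc i)))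

⨁-permute : ∀ {k} (σ τ : Fin k → Fin k) → (∀ i → σ (τ i) ≡ i) → (∀ i → τ (σ i) ≡ i) →
            (g : Fin k → Bool) → ⨁ (λ i → g (σ i)) ≡ ⨁ g
⨁-permute σ τ στ τσ g = sym (Xor.sum-permute g (permutation σ τ στ τσ))

⨁-image : ∀ {k l} (f : Fin k → Fin l) (r : Fin l → Fin k) → (∀ i → r (f i) ≡ i) →
          (q : Fin l → Bool) → ⨁ (λ e → ⌊ f (r e) ≟ e ⌋ ∧ q e) ≡ ⨁ (λ i → q (f i))
⨁-image f r rf q = begin
  ⨁ (λ e → ⌊ f (r e) ≟ e ⌋ ∧ q e)                 ≡⟨ Xor.sum-cong-≗ (λ e → ⨁-pick (r e) (λ i → ⌊ f i ≟ e ⌋ ∧ q e)) ⟨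
  ⨁ (λ e → ⨁ (λ i → ⌊ i ≟ r e ⌋ ∧ (⌊ f i ≟ e ⌋ ∧ q e)))   ≡⟨ Xor.sum-cong-≗ (λ e → Xor.sum-cong-≗ (λ i → hit i e)) ⟩
  ⨁ (λ e → ⨁ (λ i → ⌊ f i ≟ e ⌋ ∧ q e))            ≡⟨ Xor.∑-comm (λ e i → ⌊ f i ≟ e ⌋ ∧ q e) ⟩
  ⨁ (λ i → ⨁ (λ e → ⌊ f i ≟ e ⌋ ∧ q e))            ≡⟨ Xor.sum-cong-≗ (λ i → Xor.sum-cong-≗ (λ e → cong (_∧ q e) (⌊≟⌋-sym (f i) e))) ⟩
  ⨁ (λ i → ⨁ (λ e → ⌊ e ≟ f i ⌋ ∧ q e))            ≡⟨ Xor.sum-cong-≗ (λ i → ⨁-pick (f i) q) ⟩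
  ⨁ (λ i → q (f i))                                ∎
  where
  open ≡-Reasoning
  hit : ∀ i e → ⌊ i ≟ r e ⌋ ∧ (⌊ f i ≟ e ⌋ ∧ q e) ≡ ⌊ f i ≟ e ⌋ ∧ q e
  hit i e with f i ≟ e
  ... | yes refl = cong (_∧ q (f i)) (⌊⌋-true (i ≟ r (f i)) (sym (rf i)))
  ... | no _     = ∧-zeroʳ ⌊ i ≟ r e ⌋

isOdd-count : ∀ k (p : Fin k → Bool) → isOdd (count k p) ≡ ⨁ p
isOdd-count zero p = refl
isOdd-count (suc k) p with p zero
... | true  = cong not (isOdd-count k (λ i → p (suc i)))
... | false = isOdd-count k (λ i → p (suc i))

count-cong : ∀ k {p q : Fin k → Bool} → (∀ i → p i ≡ q i) → count k p ≡ count k q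
count-cong zero eq = refl
count-cong (suc k) eq = cong₂ (λ b c → (if b then 1 else 0) + c) (eq zero) (count-cong k (λ i → eq (suc i)))

count-zero : ∀ k {p : Fin k → Bool} → (∀ i → p i ≡ false) → count k p ≡ 0
count-zero zero _ = refl
count-zero (suc k) {p} none rewrite none zero = count-zero k (λ i → none (suc i))

count≡0⇒false : ∀ k {p : Fin k → Bool} → count k p ≡ 0 → ∀ i → p i ≡ false
count≡0⇒false (suc k) {p} eq i with p zero in p₀
count≡0⇒false (suc k) {p} () i       | true
count≡0⇒false (suc k) {p} eq zero    | false = p₀
count≡0⇒false (suc k) {p} eq (suc i) | false = count≡0⇒false k eq i

count-single : ∀ k {p : Fin k → Bool} (j : Fin k) → (∀ i → p i ≡ true → i ≡ j) → p j ≡ true → count k p ≡ 1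
count-single k {p} j only pⱼ = go k j (λ i i≢j → ¬-not (i≢j ∘ only i)) pⱼ
  where
  go : ∀ k {p : Fin k → Bool} (j : Fin k) → (∀ i → i ≢ j → p i ≡ false) → p j ≡ true → count k p ≡ 1
  go (suc k) zero others pⱼ rewrite pⱼ = cong suc (count-zero k (λ i → others (suc i) (λ ())))
  go (suc k) (suc j) others pⱼ rewrite others zero (λ ()) = go k j (λ i i≢j → others (suc i) (i≢j ∘ suc-injective)) pⱼ

count≡1⇒unique : ∀ k (p : Fin k → Bool) → count k p ≡ 1 →
                 Σ (Fin k) λ j → p j ≡ true × (∀ i → p i ≡ true → i ≡ j)
count≡1⇒unique (suc k) p eq with p zero in p₀
... | true  = zero , p₀ , λ where
  zero    _  → refl
  (suc i) pᵢ → contradiction (trans (sym pᵢ) (count≡0⇒false k (ℕ.suc-injective eq) i)) λ ()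
... | false with count≡1⇒unique k (λ i → p (suc i)) eq
...   | j , pⱼ , unique = suc j , pⱼ , λ where
  zero    p₀′ → contradiction (trans (sym p₀) p₀′) λ ()
  (suc i) pᵢ  → cong suc (unique i pᵢ)

count-≤ : ∀ k {p q : Fin k → Bool} → (∀ i → q i ≡ true → p i ≡ true) → count k q ℕ.≤ count k p
count-≤ zero q⊆p = z≤n
count-≤ (suc k) {p} {q} q⊆p with q zero in q₀ | p zero in p₀
... | true  | true  = s≤s (count-≤ k (q⊆p ∘ suc))
... | true  | false = contradiction (trans (sym (q⊆p zero q₀)) p₀) λ ()
... | false | true  = ℕ.m≤n⇒m≤1+n (count-≤ k (q⊆p ∘ suc))
... | false | false = count-≤ k (q⊆p ∘ suc)

count-< : ∀ k {p q : Fin k → Bool} → (∀ i → q i ≡ true → p i ≡ true) → ∀ a → p a ≡ true → q a ≡ false → count k q ℕ.< count k p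
count-< (suc k) q⊆p zero pₐ qₐ rewrite pₐ | qₐ = s≤s (count-≤ k (q⊆p ∘ suc))
count-< (suc k) {p} {q} q⊆p (suc a) pₐ qₐ with q zero in q₀ | p zero in p₀
... | true  | true  = s≤s (count-< k (q⊆p ∘ suc) a pₐ qₐ)
... | true  | false = contradiction (trans (sym (q⊆p zero q₀)) p₀) λ ()
... | false | true  = ℕ.m≤n⇒m≤1+n (count-< k (q⊆p ∘ suc) a pₐ qₐ)
... | false | false = count-< k (q⊆p ∘ suc) a pₐ qₐ

if-nonneg : ∀ b {q} → 0ℚ ≤ q → 0ℚ ≤ (if b then q else 0ℚ)
if-nonneg true  0≤q = 0≤q
if-nonneg false _   = ℚ.≤-refl

if-vanish : ∀ b {q} → q ≡ 0ℚ → (if b then q else 0ℚ) ≡ 0ℚ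
if-vanish true  q≡0 = q≡0
if-vanish false _   = refl

if-*ʳ : ∀ b p q → (if b then p * q else 0ℚ) ≡ (if b then p else 0ℚ) * q
if-*ʳ true  p q = refl
if-*ʳ false p q = sym (ℚ.*-zeroˡ q)

if-*ˡ : ∀ b p q → (if b then p * q else 0ℚ) ≡ p * (if b then q else 0ℚ)
if-*ˡ true  p q = refl
if-*ˡ false p q = sym (ℚ.*-zeroʳ p)

*-nonneg : ∀ {p q} → 0ℚ ≤ p → 0ℚ ≤ q → 0ℚ ≤ p * q
*-nonneg {p} {q} 0≤p 0≤q = ℚ.nonNegative⁻¹ (p * q) {{ℚ.nonNeg*nonNeg⇒nonNeg p {{nonNegative 0≤p}} q {{nonNegative 0≤q}}}}

𝟙 : Bool → ℚ
𝟙 b = if b then 1ℚ else 0ℚ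

𝟙-nonneg : ∀ b → 0ℚ ≤ 𝟙 b
𝟙-nonneg b = if-nonneg b (ℚ.nonNegative⁻¹ 1ℚ)

χ : ∀ {k} → Fin k → Fin k → ℚ
χ e a = 𝟙 ⌊ e ≟ a ⌋

χ-off : ∀ {k} {e a : Fin k} → e ≢ a → χ e a ≡ 0ℚ
χ-off {e = e} {a} e≢a = cong 𝟙 (⌊⌋-false (e ≟ a) e≢a)

sumQ-cong : ∀ k {f g : Fin k → ℚ} → (∀ i → f i ≡ g i) → sumQ k f ≡ sumQ k g
sumQ-cong zero eq = refl
sumQ-cong (suc k) eq = cong₂ _+ℚ_ (eq zero) (sumQ-cong k (λ i → eq (suc i)))

sumQ-+ : ∀ k (f g : Fin k → ℚ) → sumQ k (λ i → f i +ℚ g i) ≡ sumQ k f +ℚ sumQ k g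
sumQ-+ zero f g = refl
sumQ-+ (suc k) f g =
  trans (cong ((f zero +ℚ g zero) +ℚ_) (sumQ-+ k (λ i → f (suc i)) (λ i → g (suc i))))
        (ℚ+.interchange (f zero) (g zero) _ _)

sumQ-*ˡ : ∀ k c (f : Fin k → ℚ) → sumQ k (λ i → c * f i) ≡ c * sumQ k f
sumQ-*ˡ zero c f = sym (ℚ.*-zeroʳ c)
sumQ-*ˡ (suc k) c f = trans (cong (c * f zero +ℚ_) (sumQ-*ˡ k c (λ i → f (suc i)))) (sym (ℚ.*-distribˡ-+ c _ _))

sumQ-neg : ∀ k (f : Fin k → ℚ) → sumQ k (λ i → - f i) ≡ - sumQ k f
sumQ-neg zero f = refl
sumQ-neg (suc k) f = trans (cong (- f zero +ℚ_) (sumQ-neg k (λ i → f (suc i)))) (sym (ℚ.neg-distrib-+ (f zero) _))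

sumQ-zero : ∀ k {f : Fin k → ℚ} → (∀ i → f i ≡ 0ℚ) → sumQ k f ≡ 0ℚ
sumQ-zero zero eq = refl
sumQ-zero (suc k) eq = cong₂ _+ℚ_ (eq zero) (sumQ-zero k (λ i → eq (suc i)))

sumQ-single : ∀ k {f : Fin k → ℚ} (j : Fin k) → (∀ i → i ≢ j → f i ≡ 0ℚ) → sumQ k f ≡ f j
sumQ-single (suc k) {f} zero eq =
  trans (cong (f zero +ℚ_) (sumQ-zero k (λ i → eq (suc i) (λ ())))) (ℚ.+-identityʳ (f zero))
sumQ-single (suc k) (suc j) eq =
  trans (cong₂ _+ℚ_ (eq zero (λ ())) (sumQ-single k j (λ i i≢j → eq (suc i) (i≢j ∘ suc-injective)))) (ℚ.+-identityˡ _)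

sumQ-nonneg : ∀ k {f : Fin k → ℚ} → (∀ i → 0ℚ ≤ f i) → 0ℚ ≤ sumQ k f
sumQ-nonneg zero nn = ℚ.≤-refl
sumQ-nonneg (suc k) nn = ℚ.+-mono-≤ (nn zero) (sumQ-nonneg k (λ i → nn (suc i)))

term≤sumQ : ∀ k {f : Fin k → ℚ} → (∀ i → 0ℚ ≤ f i) → ∀ j → f j ≤ sumQ k f
term≤sumQ (suc k) {f} nn zero =
  ℚ.≤-trans (ℚ.≤-reflexive (sym (ℚ.+-identityʳ (f zero)))) (ℚ.+-monoʳ-≤ (f zero) (sumQ-nonneg k (λ i → nn (suc i))))
term≤sumQ (suc k) {f} nn (suc j) =
  ℚ.≤-trans (ℚ.≤-reflexive (sym (ℚ.+-identityˡ (f (suc j))))) (ℚ.+-mono-≤ (nn zero) (term≤sumQ k (λ i → nn (suc i)) j))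

two-terms≤sumQ : ∀ k {f : Fin k → ℚ} → (∀ i → 0ℚ ≤ f i) → ∀ i j → i ≢ j → f i +ℚ f j ≤ sumQ k f
two-terms≤sumQ (suc k) nn zero zero i≢j = ⊥-elim (i≢j refl)
two-terms≤sumQ (suc k) {f} nn zero (suc j) _ = ℚ.+-monoʳ-≤ (f zero) (term≤sumQ k (λ i → nn (suc i)) j)
two-terms≤sumQ (suc k) {f} nn (suc i) zero _ =
  ℚ.≤-trans (ℚ.≤-reflexive (ℚ.+-comm (f (suc i)) (f zero))) (ℚ.+-monoʳ-≤ (f zero) (term≤sumQ k (λ i → nn (suc i)) i))
two-terms≤sumQ (suc k) {f} nn (suc i) (suc j) i≢j =
  ℚ.≤-trans (ℚ.≤-reflexive (sym (ℚ.+-identityˡ _)))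
            (ℚ.+-mono-≤ (nn zero) (two-terms≤sumQ k (λ i → nn (suc i)) i j (i≢j ∘ cong suc)))

-- Perfect matchings and the easy direction

injective⇒surjective : ∀ {k} (f : Fin k → Fin k) → (∀ {i j} → f i ≡ f j → i ≡ j) → ∀ y → ∃ λ x → f x ≡ y
injective⇒surjective f inj y with any? (λ x → f x ≟ y)
... | yes hit = hit
injective⇒surjective {suc k} f inj y | no miss = contradiction (injective⇒≤ f′-injective) ℕ.1+n≰n
  where
  f′ : Fin (suc k) → Fin k
  f′ x = punchOut {i = y} {j = f x} (λ y≡fx → miss (x , sym y≡fx))
  f′-injective : ∀ {a b} → f′ a ≡ f′ b → a ≡ b
  f′-injective {a} {b} eq = inj (punchOut-injective (λ y≡fa → miss (a , sym y≡fa)) (λ y≡fb → miss (b , sym y≡fb)) eq)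

module _ {n : ℕ} (G : BipGraph n) where

  record PerfectMatching : Set where
    field
      edgeAt            : Fin n → Fin (m G)
      uE-edgeAt         : ∀ u → uE G (edgeAt u) ≡ u
      vE-edgeAt-injective : ∀ {u u′} → vE G (edgeAt u) ≡ vE G (edgeAt u′) → u ≡ u′

    mate : Fin n → Fin n
    mate v = proj₁ (injective⇒surjective (vE G ∘ edgeAt) vE-edgeAt-injective v)

    vE-edgeAt-mate : ∀ v → vE G (edgeAt (mate v)) ≡ v
    vE-edgeAt-mate v = proj₂ (injective⇒surjective (vE G ∘ edgeAt) vE-edgeAt-injective v)

    mate-vE-edgeAt : ∀ u → mate (vE G (edgeAt u)) ≡ u
    mate-vE-edgeAt u = vE-edgeAt-injective (vE-edgeAt-mate (vE G (edgeAt u)))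

    inMatching : Fin (m G) → Bool
    inMatching e = ⌊ edgeAt (uE G e) ≟ e ⌋

    redParity : Bool
    redParity = ⨁ (λ u → isRed (col G (edgeAt u)))

  module _ (P : PerfectMatching) where
    open PerfectMatching P

    inMatching-edgeAt : ∀ u → inMatching (edgeAt u) ≡ true
    inMatching-edgeAt u = ⌊⌋-true (edgeAt (uE G (edgeAt u)) ≟ edgeAt u) (cong edgeAt (uE-edgeAt u))

    inMatching⇒edgeAt : ∀ {e} → inMatching e ≡ true → edgeAt (uE G e) ≡ e
    inMatching⇒edgeAt {e} = ⌊⌋-true⁻ (edgeAt (uE G e) ≟ e)

    inMatching⇒mate : ∀ {e} → inMatching e ≡ true → mate (vE G e) ≡ uE G e
    inMatching⇒mate {e} mₑ = trans (cong (mate ∘ vE G) (sym (inMatching⇒edgeAt mₑ))) (mate-vE-edgeAt (uE G e))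

    matchedAtU : ∀ u e → incU G u e ≡ true → inMatching e ≡ true → e ≡ edgeAt u
    matchedAtU u e atU mₑ = trans (sym (inMatching⇒edgeAt mₑ)) (cong edgeAt (⌊⌋-true⁻ (uE G e ≟ u) atU))

    matchedAtV : ∀ v e → incV G v e ≡ true → inMatching e ≡ true → e ≡ edgeAt (mate v)
    matchedAtV v e atV mₑ =
      trans (sym (inMatching⇒edgeAt mₑ)) (cong edgeAt (trans (sym (inMatching⇒mate mₑ)) (cong mate (⌊⌋-true⁻ (vE G e ≟ v) atV))))

    isPerfectMatching : IsPerfectMatching G inMatching
    isPerfectMatching =
        (λ u → count-single (m G) (edgeAt u) (λ e eq → matchedAtU u e (proj₂ (∧-true⁻ eq)) (proj₁ (∧-true⁻ eq)))
                            (cong₂ _∧_ (inMatching-edgeAt u) (⌊⌋-true (_ ≟ u) (uE-edgeAt u))))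
      , (λ v → count-single (m G) (edgeAt (mate v)) (λ e eq → matchedAtV v e (proj₂ (∧-true⁻ eq)) (proj₁ (∧-true⁻ eq)))
                            (cong₂ _∧_ (inMatching-edgeAt (mate v)) (⌊⌋-true (_ ≟ v) (vE-edgeAt-mate v))))

  fromIsPerfectMatching : ∀ {M} → IsPerfectMatching G M → Σ PerfectMatching λ P → ∀ e → M e ≡ PerfectMatching.inMatching P e
  fromIsPerfectMatching {M} (atU , atV) = P , M≗inMatching
    where
    edgeAtU : ∀ u → Σ (Fin (m G)) λ j → M j ∧ incU G u j ≡ true × (∀ e → M e ∧ incU G u e ≡ true → e ≡ j)
    edgeAtU u = count≡1⇒unique (m G) _ (atU u)
    edgeAtV : ∀ v → Σ (Fin (m G)) λ j → M j ∧ incV G v j ≡ true × (∀ e → M e ∧ incV G v e ≡ true → e ≡ j)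
    edgeAtV v = count≡1⇒unique (m G) _ (atV v)
    edgeAt : Fin n → Fin (m G)
    edgeAt u = proj₁ (edgeAtU u)
    M-edgeAt : ∀ u → M (edgeAt u) ≡ true
    M-edgeAt u = proj₁ (∧-true⁻ (proj₁ (proj₂ (edgeAtU u))))
    uE-edgeAt : ∀ u → uE G (edgeAt u) ≡ u
    uE-edgeAt u = ⌊⌋-true⁻ (_ ≟ u) (proj₂ (∧-true⁻ (proj₁ (proj₂ (edgeAtU u)))))
    edgeAt-unique : ∀ e → M e ≡ true → edgeAt (uE G e) ≡ e
    edgeAt-unique e Mₑ = sym (proj₂ (proj₂ (edgeAtU (uE G e))) e (cong₂ _∧_ Mₑ (⌊⌋-true (uE G e ≟ uE G e) refl)))
    vE-edgeAt-injective : ∀ {u u′} → vE G (edgeAt u) ≡ vE G (edgeAt u′) → u ≡ u′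
    vE-edgeAt-injective {u} {u′} eq = begin
      u                     ≡⟨ uE-edgeAt u ⟨
      uE G (edgeAt u)       ≡⟨ cong (uE G) (trans (atv u refl) (sym (atv u′ (sym eq)))) ⟩
      uE G (edgeAt u′)      ≡⟨ uE-edgeAt u′ ⟩
      u′                    ∎
      where
      open ≡-Reasoning
      atv : ∀ w → vE G (edgeAt w) ≡ vE G (edgeAt u) → edgeAt w ≡ proj₁ (edgeAtV (vE G (edgeAt u)))
      atv w eq′ = proj₂ (proj₂ (edgeAtV _)) (edgeAt w) (cong₂ _∧_ (M-edgeAt w) (⌊⌋-true (_ ≟ _) eq′))
    P : PerfectMatching
    P = record { edgeAt = edgeAt ; uE-edgeAt = uE-edgeAt ; vE-edgeAt-injective = vE-edgeAt-injective }
    M≗inMatching : ∀ e → M e ≡ PerfectMatching.inMatching P e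
    M≗inMatching e with M e in Mₑ
    ... | true  = sym (⌊⌋-true (edgeAt (uE G e) ≟ e) (edgeAt-unique e Mₑ))
    ... | false = sym (⌊⌋-false (edgeAt (uE G e) ≟ e) λ eq →
                    contradiction (trans (sym (subst (λ e′ → M e′ ≡ true) eq (M-edgeAt (uE G e)))) Mₑ) λ ())

  inEL-xor : ∀ LU LV e → inEL G LU LV e ≡ not (LU (uE G e) xor (LV (vE G e) xor isRed (col G e)))
  inEL-xor LU LV e with LU (uE G e) | LV (vE G e) | col G e
  ... | true  | true  | red  = refl
  ... | true  | true  | blue = refl
  ... | true  | false | red  = refl
  ... | true  | false | blue = refl
  ... | false | true  | red  = refl
  ... | false | true  | blue = refl
  ... | false | false | red  = refl
  ... | false | false | blue = refl

  InLall⇒ : ∀ LU LV → InLall n LU LV → ⨁ LU xor ⨁ LV ≡ isOdd n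
  InLall⇒ LU LV inL = begin
    ⨁ LU xor ⨁ LV                              ≡⟨ cong₂ _xor_ (isOdd-count n LU) (isOdd-count n LV) ⟨
    isOdd (count n LU) xor isOdd (count n LV)  ≡⟨ isOdd-+ (count n LU) (count n LV) ⟨
    isOdd (count n LU + count n LV)            ≡⟨ %2≡⇒isOdd≡ (count n LU + count n LV) n inL ⟩
    isOdd n                                    ∎
    where open ≡-Reasoning

  ⇒InLall : ∀ LU LV → ⨁ LU xor ⨁ LV ≡ isOdd n → InLall n LU LV
  ⇒InLall LU LV eq = isOdd≡⇒%2≡ (count n LU + count n LV) n (begin
    isOdd (count n LU + count n LV)            ≡⟨ isOdd-+ (count n LU) (count n LV) ⟩
    isOdd (count n LU) xor isOdd (count n LV)  ≡⟨ cong₂ _xor_ (isOdd-count n LU) (isOdd-count n LV) ⟩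
    ⨁ LU xor ⨁ LV                              ≡⟨ eq ⟩
    isOdd n                                    ∎)
    where open ≡-Reasoning

  module _ (P : PerfectMatching) where
    open PerfectMatching P

    isOdd-count-red : isOdd (count (m G) (λ e → inMatching e ∧ isRed (col G e))) ≡ redParity
    isOdd-count-red = trans (isOdd-count (m G) _) (⨁-image edgeAt (uE G) uE-edgeAt (λ e → isRed (col G e)))

    hasOddRedPM : redParity ≡ true → HasOddRedPM G
    hasOddRedPM odd = inMatching , isPerfectMatching P , isOdd≡⇒%2≡ (count (m G) (λ e → inMatching e ∧ isRed (col G e))) 1 (trans isOdd-count-red odd)

    ⨁-inEL-edgeAt : ∀ LU LV → ⨁ (λ u → inEL G LU LV (edgeAt u)) ≡ isOdd n xor ((⨁ LU xor ⨁ LV) xor redParity)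
    ⨁-inEL-edgeAt LU LV = begin
      ⨁ (λ u → inEL G LU LV (edgeAt u))
        ≡⟨ Xor.sum-cong-≗ (λ u → trans (inEL-xor LU LV (edgeAt u)) (cong (λ w → not (LU w xor _)) (uE-edgeAt u))) ⟩
      ⨁ (λ u → true xor (LU u xor (LV (vE G (edgeAt u)) xor isRed (col G (edgeAt u)))))
        ≡⟨ Xor.∑-distrib-+ (λ _ → true) (λ u → LU u xor (LV (vE G (edgeAt u)) xor isRed (col G (edgeAt u)))) ⟩
      ⨁ {n} (λ _ → true) xor ⨁ (λ u → LU u xor (LV (vE G (edgeAt u)) xor isRed (col G (edgeAt u))))
        ≡⟨ cong₂ _xor_ (⨁-true n) (Xor.∑-distrib-+ LU (λ u → LV (vE G (edgeAt u)) xor isRed (col G (edgeAt u)))) ⟩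
      isOdd n xor (⨁ LU xor ⨁ (λ u → LV (vE G (edgeAt u)) xor isRed (col G (edgeAt u))))
        ≡⟨ cong (λ b → isOdd n xor (⨁ LU xor b)) (Xor.∑-distrib-+ (LV ∘ vE G ∘ edgeAt) (λ u → isRed (col G (edgeAt u)))) ⟩
      isOdd n xor (⨁ LU xor (⨁ (LV ∘ vE G ∘ edgeAt) xor redParity))
        ≡⟨ cong (λ b → isOdd n xor (⨁ LU xor (b xor redParity))) (⨁-permute (vE G ∘ edgeAt) mate vE-edgeAt-mate mate-vE-edgeAt LV) ⟩
      isOdd n xor (⨁ LU xor (⨁ LV xor redParity))
        ≡⟨ cong (isOdd n xor_) (xor-assoc (⨁ LU) (⨁ LV) redParity) ⟨
      isOdd n xor ((⨁ LU xor ⨁ LV) xor redParity) ∎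
      where open ≡-Reasoning

    indicator : Fin (m G) → ℚ
    indicator e = 𝟙 (inMatching e)

    indicator-nonneg : ∀ e → 0ℚ ≤ indicator e
    indicator-nonneg e = 𝟙-nonneg (inMatching e)

    sumOver-indicator : ∀ p j → (∀ e → p e ≡ true → inMatching e ≡ true → e ≡ j) →
                        p j ≡ true → inMatching j ≡ true → sumOver G p indicator ≡ 1ℚ
    sumOver-indicator p j only pⱼ mⱼ = trans (sumQ-single (m G) j others) (cong₂ (λ b c → if b then 𝟙 c else 0ℚ) pⱼ mⱼ)
      where
      others : ∀ e → e ≢ j → (if p e then indicator e else 0ℚ) ≡ 0ℚ
      others e e≢j with p e in pₑ | inMatching e in mₑ
      ... | true  | true  = contradiction (only e pₑ mₑ) e≢j
      ... | true  | false = refl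
      ... | false | _     = refl

    indicator-feasible : redParity ≡ true → Feasible G
    indicator-feasible odd = indicator , degU , degV , cover , indicator-nonneg
      where
      degU : ∀ u → sumOver G (incU G u) indicator ≡ 1ℚ
      degU u = sumOver-indicator (incU G u) (edgeAt u) (matchedAtU P u) (⌊⌋-true (_ ≟ u) (uE-edgeAt u)) (inMatching-edgeAt P u)
      degV : ∀ v → sumOver G (incV G v) indicator ≡ 1ℚ
      degV v = sumOver-indicator (incV G v) (edgeAt (mate v)) (matchedAtV P v) (⌊⌋-true (_ ≟ v) (vE-edgeAt-mate v)) (inMatching-edgeAt P (mate v))
      cover : ∀ LU LV → InLall n LU LV → 1ℚ ≤ sumOver G (inEL G LU LV) indicator
      cover LU LV inL with ⨁-true⇒∃ (λ u → inEL G LU LV (edgeAt u)) (begin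
          ⨁ (λ u → inEL G LU LV (edgeAt u))                   ≡⟨ ⨁-inEL-edgeAt LU LV ⟩
          isOdd n xor ((⨁ LU xor ⨁ LV) xor redParity)         ≡⟨ cong (λ b → isOdd n xor (b xor redParity)) (InLall⇒ LU LV inL) ⟩
          isOdd n xor (isOdd n xor redParity)                  ≡⟨ xor-cancelˡ (isOdd n) redParity ⟩
          redParity                                            ≡⟨ odd ⟩
          true                                                 ∎)
        where open ≡-Reasoning
      ... | u , hit =
        ℚ.≤-trans (ℚ.≤-reflexive (sym (cong₂ (λ b c → if b then 𝟙 c else 0ℚ) hit (inMatching-edgeAt P u))))
                  (term≤sumQ (m G) (λ e → if-nonneg (inEL G LU LV e) (indicator-nonneg e)) (edgeAt u))

  oddRedPM⇒feasible : HasOddRedPM G → Feasible G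
  oddRedPM⇒feasible (M , isPM , odd) with fromIsPerfectMatching isPM
  ... | P , M≗inMatching = indicator-feasible P (begin
    PerfectMatching.redParity P                                                    ≡⟨ isOdd-count-red P ⟨
    isOdd (count (m G) (λ e → PerfectMatching.inMatching P e ∧ isRed (col G e)))  ≡⟨ cong isOdd (count-cong (m G) (λ e → cong (_∧ isRed (col G e)) (M≗inMatching e))) ⟨
    isOdd (count (m G) (λ e → M e ∧ isRed (col G e)))                            ≡⟨ %2≡⇒isOdd≡ (count (m G) (λ e → M e ∧ isRed (col G e))) 1 odd ⟩
    true                                                                          ∎)
    where open ≡-Reasoning

-- Integrality of fractional perfect matchings

telescope : ∀ a b c → (a - b) +ℚ (b - c) ≡ a - c
telescope = solve 3 (λ a b c → (a :- b) :+ (b :- c) := a :- c) refl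
  where open +-*-Solver

÷-*-cancel : ∀ p q .{{_ : NonZero q}} → (p ÷ q) * q ≡ p
÷-*-cancel p q = begin
  (p * 1/ q) * q   ≡⟨ ℚ.*-assoc p (1/ q) q ⟩
  p * (1/ q * q)   ≡⟨ cong (p *_) (ℚ.*-inverseˡ q) ⟩
  p * 1ℚ           ≡⟨ ℚ.*-identityʳ p ⟩
  p                ∎
  where open ≡-Reasoning

+-*-neg : ∀ p t q → p +ℚ t * q ≡ p - t * (- q)
+-*-neg = solve 3 (λ p t q → p :+ t :* q := p :- t :* (:- q)) refl
  where open +-*-Solver

step-nonneg : ∀ {p t q} → 0ℚ ≤ p → 0ℚ ≤ t → (q < 0ℚ → t * (- q) ≤ p) → 0ℚ ≤ p +ℚ t * q
step-nonneg {p} {t} {q} 0≤p 0≤t bound with q ℚ.<? 0ℚ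
... | no q≮0 = ℚ.+-mono-≤ 0≤p (*-nonneg 0≤t (ℚ.≮⇒≥ q≮0))
... | yes q<0 = begin
  0ℚ                         ≡⟨ ℚ.+-inverseʳ (t * (- q)) ⟨
  t * (- q) - t * (- q)      ≤⟨ ℚ.+-monoˡ-≤ (- (t * (- q))) (bound q<0) ⟩
  p - t * (- q)              ≡⟨ +-*-neg p t q ⟨
  p +ℚ t * q                 ∎
  where open ℚ.≤-Reasoning

record RatioStep {k} (x d : Fin k → ℚ) : Set where
  field
    t                   : ℚ
    nonneg              : ∀ a → 0ℚ ≤ x a +ℚ t * d a
    blocking            : Fin k
    blocking-decreasing : d blocking < 0ℚ
    blocking-vanishes   : x blocking +ℚ t * d blocking ≡ 0ℚ

ratioTest : ∀ {k} (x d : Fin k → ℚ) → (∀ a → 0ℚ ≤ x a) → (∃ λ a → d a < 0ℚ) → RatioStep x d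
ratioTest {k} x d x≥0 (a* , d<0) = record { t = t ; nonneg = x′≥0 ; blocking = a₀ ; blocking-decreasing = d₀<0 ; blocking-vanishes = x′₀≡0 }
  where
  -- x a / (- d a) where d a < 0; the junk value 0 elsewhere is never compared.
  ratio : Fin k → ℚ
  ratio a with d a ℚ.<? 0ℚ
  ... | yes neg = (x a ÷ (- d a)) {{ℚ.pos⇒nonZero (- d a) {{positive (ℚ.neg-antimono-< neg)}}}}
  ... | no _    = 0ℚ
  ratio-spec : ∀ a → d a < 0ℚ → ratio a * (- d a) ≡ x a
  ratio-spec a neg with d a ℚ.<? 0ℚ
  ... | yes neg′ = ÷-*-cancel (x a) (- d a) {{ℚ.pos⇒nonZero (- d a) {{positive (ℚ.neg-antimono-< neg′)}}}}
  ... | no ¬neg = contradiction neg ¬neg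
  a₀ : Fin k
  a₀ = argmin ratio a* (filter (λ a → d a ℚ.<? 0ℚ) (allFin k))
  d₀<0 : d a₀ < 0ℚ
  d₀<0 = argmin-all ratio d<0 (All.all-filter (λ a → d a ℚ.<? 0ℚ) (allFin k))
  t : ℚ
  t = ratio a₀
  t-min : ∀ a → d a < 0ℚ → t ≤ ratio a
  t-min a neg = All.lookup (f[argmin]≤f[xs] a* _) (∈-filter⁺ (λ a → d a ℚ.<? 0ℚ) (∈-allFin a) neg)
  t≥0 : 0ℚ ≤ t
  t≥0 = ℚ.*-cancelʳ-≤-pos (- d a₀) {{positive (ℚ.neg-antimono-< d₀<0)}}
          (ℚ.≤-trans (ℚ.≤-reflexive (ℚ.*-zeroˡ (- d a₀))) (ℚ.≤-trans (x≥0 a₀) (ℚ.≤-reflexive (sym (ratio-spec a₀ d₀<0)))))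
  x′≥0 : ∀ a → 0ℚ ≤ x a +ℚ t * d a
  x′≥0 a = step-nonneg (x≥0 a) t≥0 λ neg →
    ℚ.≤-trans (ℚ.*-monoʳ-≤-nonNeg (- d a) {{nonNegative (ℚ.<⇒≤ (ℚ.neg-antimono-< neg))}} (t-min a neg)) (ℚ.≤-reflexive (ratio-spec a neg))
  x′₀≡0 : x a₀ +ℚ t * d a₀ ≡ 0ℚ
  x′₀≡0 = trans (+-*-neg (x a₀) t (d a₀)) (trans (cong (λ y → x a₀ - y) (ratio-spec a₀ d₀<0)) (ℚ.+-inverseʳ (x a₀)))

NoRepeatBelow : ∀ {A : Set} → (ℕ → A) → ℕ → Set
NoRepeatBelow f j = ∀ {a b} → a ℕ.< b → b ℕ.< j → f a ≢ f b

firstRepeat : ∀ {n} (f : ℕ → Fin n) → ∃₂ λ i c → f i ≡ f (i + suc c) × (∀ {a b} → a ℕ.< b → b ℕ.≤ c → f (i + a) ≢ f (i + b))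
firstRepeat {n} f = search (suc n) 0 (ℕ.+-identityʳ (suc n)) (λ _ ())
  where
  search : ∀ fuel j → fuel + j ≡ suc n → NoRepeatBelow f j →
           ∃₂ λ i c → f i ≡ f (i + suc c) × (∀ {a b} → a ℕ.< b → b ℕ.≤ c → f (i + a) ≢ f (i + b))
  search zero j refl noRepeat with pigeonhole (ℕ.n<1+n n) (f ∘ toℕ)
  ... | a , b , a<b , fa≡fb = contradiction fa≡fb (noRepeat a<b (toℕ<n b))
  search (suc fuel) j eq noRepeat with any? (λ (a : Fin j) → f (toℕ a) ≟ f j)
  ... | yes (a , fa≡fj) with ℕ.m≤n⇒∃[o]m+o≡n (toℕ<n a)
  ...   | c , a+c≡j = toℕ a , c , subst (λ j′ → f (toℕ a) ≡ f j′) j≡ fa≡fj , window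
    where
    j≡ : j ≡ toℕ a + suc c
    j≡ = trans (sym a+c≡j) (sym (ℕ.+-suc (toℕ a) c))
    window : ∀ {b b′} → b ℕ.< b′ → b′ ℕ.≤ c → f (toℕ a + b) ≢ f (toℕ a + b′)
    window {b′ = b′} b<b′ b′≤c =
      noRepeat (ℕ.+-monoʳ-< (toℕ a) b<b′) (subst (toℕ a + b′ ℕ.<_) (sym j≡) (ℕ.+-monoʳ-< (toℕ a) (s≤s b′≤c)))
  search (suc fuel) j eq noRepeat | no fresh = search fuel (suc j) (trans (ℕ.+-suc fuel j) eq) noRepeat′
    where
    noRepeat′ : NoRepeatBelow f (suc j)
    noRepeat′ {a} {b} a<b (s≤s b≤j) with ℕ.m≤n⇒m<n∨m≡n b≤j
    ... | inj₁ b<j  = noRepeat a<b b<j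
    ... | inj₂ refl = λ fa≡fb → fresh (fromℕ< a<b , trans (cong f (toℕ-fromℕ< a<b)) fa≡fb)

module _ {n : ℕ} (G : BipGraph n) where

  private
    E : ℕ
    E = m G

  sumOver-+ : ∀ p (f g : Fin E → ℚ) → sumOver G p (λ e → f e +ℚ g e) ≡ sumOver G p f +ℚ sumOver G p g
  sumOver-+ p f g = trans (sumQ-cong E split) (sumQ-+ E _ _)
    where
    split : ∀ e → (if p e then f e +ℚ g e else 0ℚ) ≡ (if p e then f e else 0ℚ) +ℚ (if p e then g e else 0ℚ)
    split e with p e
    ... | true  = refl
    ... | false = refl

  sumOver-*ˡ : ∀ p c (f : Fin E → ℚ) → sumOver G p (λ e → c * f e) ≡ c * sumOver G p f
  sumOver-*ˡ p c f = trans (sumQ-cong E (λ e → if-*ˡ (p e) c (f e))) (sumQ-*ˡ E c _)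

  sumOver-neg : ∀ p (f : Fin E → ℚ) → sumOver G p (λ e → - f e) ≡ - sumOver G p f
  sumOver-neg p f = trans (sumQ-cong E pull) (sumQ-neg E _)
    where
    pull : ∀ e → (if p e then - f e else 0ℚ) ≡ - (if p e then f e else 0ℚ)
    pull e with p e
    ... | true  = refl
    ... | false = refl

  sumOver-zero : ∀ p → sumOver G p (λ _ → 0ℚ) ≡ 0ℚ
  sumOver-zero p = sumQ-zero E (λ e → if-vanish (p e) refl)

  sumOver-χ : ∀ p e → sumOver G p (χ e) ≡ 𝟙 (p e)
  sumOver-χ p e = trans (sumQ-single E e others) at-e
    where
    others : ∀ a → a ≢ e → (if p a then χ e a else 0ℚ) ≡ 0ℚ
    others a a≢e with p a
    ... | true  = χ-off (a≢e ∘ sym)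
    ... | false = refl
    at-e : (if p e then χ e e else 0ℚ) ≡ 𝟙 (p e)
    at-e with p e
    ... | true  = cong 𝟙 (⌊⌋-true (e ≟ e) refl)
    ... | false = refl

  IsFractionalPM : (Fin E → ℚ) → Set
  IsFractionalPM x = (∀ u → sumOver G (incU G u) x ≡ 1ℚ) × (∀ v → sumOver G (incV G v) x ≡ 1ℚ) × (∀ e → 0ℚ ≤ x e)

  Fractional : (Fin E → ℚ) → Fin E → Set
  Fractional x e = 0ℚ < x e × x e < 1ℚ

  module Star (x : Fin E → ℚ) (x≥0 : ∀ e → 0ℚ ≤ x e) (p : Fin E → Bool) (total : sumOver G p x ≡ 1ℚ) where

    private
      summand : Fin E → ℚ
      summand e = if p e then x e else 0ℚ

      summand-nonneg : ∀ e → 0ℚ ≤ summand e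
      summand-nonneg e = if-nonneg (p e) (x≥0 e)

      summand-in : ∀ {e} → p e ≡ true → summand e ≡ x e
      summand-in pₑ rewrite pₑ = refl

      summand-zero : ∀ e → (p e ≡ true → ¬ (0ℚ < x e)) → summand e ≡ 0ℚ
      summand-zero e off with p e
      ... | true  = ℚ.≤-antisym (ℚ.≮⇒≥ (off refl)) (x≥0 e)
      ... | false = refl

    positiveEdge : ∃ λ e → p e ≡ true × 0ℚ < x e
    positiveEdge with any? (λ e → (p e Bool.≟ true) ×-dec (0ℚ ℚ.<? x e))
    ... | yes hit  = hit
    ... | no none = contradiction (trans (sym total) (sumQ-zero E (λ e → summand-zero e (λ pₑ 0<xₑ → none (e , pₑ , 0<xₑ))))) λ ()

    othersBelow1 : ∀ {a b} → p a ≡ true → p b ≡ true → a ≢ b → 0ℚ < x a → x b < 1ℚ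
    othersBelow1 {a} {b} pₐ p_b a≢b 0<xₐ = begin-strict
      x b                     ≡⟨ ℚ.+-identityˡ (x b) ⟨
      0ℚ +ℚ x b               <⟨ ℚ.+-monoˡ-< (x b) 0<xₐ ⟩
      x a +ℚ x b              ≡⟨ cong₂ _+ℚ_ (summand-in pₐ) (summand-in p_b) ⟨
      summand a +ℚ summand b  ≤⟨ two-terms≤sumQ E summand-nonneg a b a≢b ⟩
      sumOver G p x           ≡⟨ total ⟩
      1ℚ                      ∎
      where open ℚ.≤-Reasoning

    anotherFractional : ∀ {g} → p g ≡ true → Fractional x g → ∃ λ e → p e ≡ true × e ≢ g × Fractional x e
    anotherFractional {g} p_g (0<x_g , x_g<1) with any? (λ e → (p e Bool.≟ true) ×-dec (¬? (e ≟ g)) ×-dec (0ℚ ℚ.<? x e))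
    ... | yes (e , pₑ , e≢g , 0<xₑ) = e , pₑ , e≢g , 0<xₑ , othersBelow1 p_g pₑ (e≢g ∘ sym) 0<x_g
    ... | no none = ⊥-elim (ℚ.<-irrefl x_g≡1 x_g<1)
      where
      x_g≡1 : x g ≡ 1ℚ
      x_g≡1 = trans (sym (summand-in p_g))
                    (trans (sym (sumQ-single E g λ e e≢g → summand-zero e (λ pₑ 0<xₑ → none (e , pₑ , e≢g , 0<xₑ)))) total)

  support : (Fin E → ℚ) → ℕ
  support x = count E (λ e → ⌊ 0ℚ ℚ.<? x e ⌋)

  SmallerFractionalPM : (Fin E → ℚ) → Set
  SmallerFractionalPM x = Σ (Fin E → ℚ) λ x′ → IsFractionalPM x′ × (∀ a → 0ℚ < x′ a → 0ℚ < x a) × support x′ ℕ.< support x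

  PerfectMatchingWithin : (Fin E → ℚ) → Set
  PerfectMatchingWithin x = Σ (PerfectMatching G) λ P → ∀ u → 0ℚ < x (PerfectMatching.edgeAt P u)

  record BalancedDirection (x : Fin E → ℚ) : Set where
    field
      d          : Fin E → ℚ
      balancedU  : ∀ u → sumOver G (incU G u) d ≡ 0ℚ
      balancedV  : ∀ v → sumOver G (incV G v) d ≡ 0ℚ
      supported  : ∀ a → ¬ (0ℚ < x a) → d a ≡ 0ℚ
      decreasing : ∃ λ a → d a < 0ℚ

  cancel : ∀ {x} → IsFractionalPM x → BalancedDirection x → SmallerFractionalPM x
  cancel {x} fpm dir = shiftBy (ratioTest x d (proj₂ (proj₂ fpm)) decreasing)
    where
    open BalancedDirection dir
    shiftBy : RatioStep x d → SmallerFractionalPM x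
    shiftBy step = x′ , (degU′ , degV′ , nonneg) , shrinks , smaller
      where
      open RatioStep step
      x′ : Fin E → ℚ
      x′ a = x a +ℚ t * d a
      shifted-total : ∀ p → sumOver G p x ≡ 1ℚ → sumOver G p d ≡ 0ℚ → sumOver G p x′ ≡ 1ℚ
      shifted-total p x-total d-total = begin
        sumOver G p x′                                 ≡⟨ sumOver-+ p x (λ a → t * d a) ⟩
        sumOver G p x +ℚ sumOver G p (λ a → t * d a)   ≡⟨ cong (sumOver G p x +ℚ_) (sumOver-*ˡ p t d) ⟩
        sumOver G p x +ℚ t * sumOver G p d             ≡⟨ cong₂ (λ a b → a +ℚ t * b) x-total d-total ⟩
        1ℚ +ℚ t * 0ℚ                                   ≡⟨ cong (1ℚ +ℚ_) (ℚ.*-zeroʳ t) ⟩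
        1ℚ +ℚ 0ℚ                                       ≡⟨ ℚ.+-identityʳ 1ℚ ⟩
        1ℚ                                             ∎
        where open ≡-Reasoning
      degU′ : ∀ u → sumOver G (incU G u) x′ ≡ 1ℚ
      degU′ u = shifted-total (incU G u) (proj₁ fpm u) (balancedU u)
      degV′ : ∀ v → sumOver G (incV G v) x′ ≡ 1ℚ
      degV′ v = shifted-total (incV G v) (proj₁ (proj₂ fpm) v) (balancedV v)
      unchanged : ∀ a → ¬ (0ℚ < x a) → x′ a ≡ x a
      unchanged a x≯0 = trans (cong (λ q → x a +ℚ t * q) (supported a x≯0)) (trans (cong (x a +ℚ_) (ℚ.*-zeroʳ t)) (ℚ.+-identityʳ (x a)))
      shrinks : ∀ a → 0ℚ < x′ a → 0ℚ < x a
      shrinks a 0<x′ with 0ℚ ℚ.<? x a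
      ... | yes 0<x = 0<x
      ... | no x≯0 = contradiction (subst (0ℚ <_) (unchanged a x≯0) 0<x′) x≯0
      blocking-positive : 0ℚ < x blocking
      blocking-positive with 0ℚ ℚ.<? x blocking
      ... | yes 0<x = 0<x
      ... | no x≯0 = contradiction (supported blocking x≯0) (ℚ.<⇒≢ blocking-decreasing)
      smaller : support x′ ℕ.< support x
      smaller = count-< E (λ a pos → ⌊⌋-true (0ℚ ℚ.<? x a) (shrinks a (⌊⌋-true⁻ (0ℚ ℚ.<? x′ a) pos)))
                  blocking (⌊⌋-true (0ℚ ℚ.<? x blocking) blocking-positive)
                  (⌊⌋-false (0ℚ ℚ.<? x′ blocking) (ℚ.<-irrefl (sym blocking-vanishes)))

  module AlternatingWalk {x : Fin E → ℚ} (fpm : IsFractionalPM x) where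

    private
      x≥0 : ∀ e → 0ℚ ≤ x e
      x≥0 = proj₂ (proj₂ fpm)

    -- Iterating `next` alternates between the V-end inside a link and the U-end between links,
    -- so the links trace an alternating walk of fractional edges.
    record Link : Set where
      field
        enter leave      : Fin E
        enter-fractional : Fractional x enter
        leave-fractional : Fractional x leave
        vE-leave         : vE G leave ≡ vE G enter
        leave≢enter      : leave ≢ enter
    open Link public

    linkFrom : ∀ e → Fractional x e → Link
    linkFrom e frac with Star.anotherFractional x x≥0 (incV G (vE G e)) (proj₁ (proj₂ fpm) (vE G e)) (⌊⌋-true (vE G e ≟ vE G e) refl) frac
    ... | e′ , at-v , e′≢e , frac′ = record
      { enter = e ; leave = e′ ; enter-fractional = frac ; leave-fractional = frac′
      ; vE-leave = ⌊⌋-true⁻ (vE G e′ ≟ vE G e) at-v ; leave≢enter = e′≢e }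

    nextEnter : (l : Link) → ∃ λ e → incU G (uE G (leave l)) e ≡ true × e ≢ leave l × Fractional x e
    nextEnter l = Star.anotherFractional x x≥0 (incU G (uE G (leave l))) (proj₁ fpm (uE G (leave l)))
                    (⌊⌋-true (uE G (leave l) ≟ uE G (leave l)) refl) (leave-fractional l)

    next : Link → Link
    next l = linkFrom (proj₁ (nextEnter l)) (proj₂ (proj₂ (proj₂ (nextEnter l))))

    uE-enter-next : ∀ l → uE G (enter (next l)) ≡ uE G (leave l)
    uE-enter-next l = ⌊⌋-true⁻ (_ ≟ _) (proj₁ (proj₂ (nextEnter l)))

    enter-next≢leave : ∀ l → enter (next l) ≢ leave l
    enter-next≢leave l = proj₁ (proj₂ (proj₂ (nextEnter l)))

    source : Link → Fin n
    source l = uE G (enter l)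

    walk : Link → ℕ → Link
    walk = iterate next

    walk-+ : ∀ l i k → walk l (i + k) ≡ walk (walk l i) k
    walk-+ l zero    k = refl
    walk-+ l (suc i) k = walk-+ (next l) i k

    step : Link → Fin E → ℚ
    step l a = χ (enter l) a - χ (leave l) a

    direction : Link → ℕ → Fin E → ℚ
    direction l zero    a = 0ℚ
    direction l (suc c) a = step l a +ℚ direction (next l) c a

    sumOver-step : ∀ p l → sumOver G p (step l) ≡ 𝟙 (p (enter l)) - 𝟙 (p (leave l))
    sumOver-step p l = begin
      sumOver G p (step l)                                          ≡⟨ sumOver-+ p (χ (enter l)) (λ a → - χ (leave l) a) ⟩
      sumOver G p (χ (enter l)) +ℚ sumOver G p (λ a → - χ (leave l) a) ≡⟨ cong₂ _+ℚ_ (sumOver-χ p (enter l)) (sumOver-neg p (χ (leave l))) ⟩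
      𝟙 (p (enter l)) - sumOver G p (χ (leave l))                     ≡⟨ cong (λ q → 𝟙 (p (enter l)) - q) (sumOver-χ p (leave l)) ⟩
      𝟙 (p (enter l)) - 𝟙 (p (leave l))                               ∎
      where open ≡-Reasoning

    direction-balancedU : ∀ y l c → sumOver G (incU G y) (direction l c) ≡ 𝟙 ⌊ source l ≟ y ⌋ - 𝟙 ⌊ source (walk l c) ≟ y ⌋
    direction-balancedU y l zero = trans (sumOver-zero (incU G y)) (sym (ℚ.+-inverseʳ (𝟙 ⌊ source l ≟ y ⌋)))
    direction-balancedU y l (suc c) = begin
      sumOver G (incU G y) (direction l (suc c))
        ≡⟨ sumOver-+ (incU G y) (step l) (direction (next l) c) ⟩
      sumOver G (incU G y) (step l) +ℚ sumOver G (incU G y) (direction (next l) c)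
        ≡⟨ cong₂ _+ℚ_ (sumOver-step (incU G y) l) (direction-balancedU y (next l) c) ⟩
      (𝟙 ⌊ source l ≟ y ⌋ - 𝟙 ⌊ uE G (leave l) ≟ y ⌋) +ℚ (𝟙 ⌊ source (next l) ≟ y ⌋ - 𝟙 ⌊ source (walk l (suc c)) ≟ y ⌋)
        ≡⟨ cong (λ w → (𝟙 ⌊ source l ≟ y ⌋ - 𝟙 ⌊ w ≟ y ⌋) +ℚ (𝟙 ⌊ source (next l) ≟ y ⌋ - 𝟙 ⌊ source (walk l (suc c)) ≟ y ⌋)) (sym (uE-enter-next l)) ⟩
      (𝟙 ⌊ source l ≟ y ⌋ - 𝟙 ⌊ source (next l) ≟ y ⌋) +ℚ (𝟙 ⌊ source (next l) ≟ y ⌋ - 𝟙 ⌊ source (walk l (suc c)) ≟ y ⌋)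
        ≡⟨ telescope (𝟙 ⌊ source l ≟ y ⌋) (𝟙 ⌊ source (next l) ≟ y ⌋) (𝟙 ⌊ source (walk l (suc c)) ≟ y ⌋) ⟩
      𝟙 ⌊ source l ≟ y ⌋ - 𝟙 ⌊ source (walk l (suc c)) ≟ y ⌋
        ∎
      where open ≡-Reasoning

    direction-balancedV : ∀ y l c → sumOver G (incV G y) (direction l c) ≡ 0ℚ
    direction-balancedV y l zero = sumOver-zero (incV G y)
    direction-balancedV y l (suc c) = begin
      sumOver G (incV G y) (direction l (suc c))
        ≡⟨ sumOver-+ (incV G y) (step l) (direction (next l) c) ⟩
      sumOver G (incV G y) (step l) +ℚ sumOver G (incV G y) (direction (next l) c)
        ≡⟨ cong₂ _+ℚ_ (sumOver-step (incV G y) l) (direction-balancedV y (next l) c) ⟩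
      (𝟙 ⌊ vE G (enter l) ≟ y ⌋ - 𝟙 ⌊ vE G (leave l) ≟ y ⌋) +ℚ 0ℚ
        ≡⟨ cong (λ w → (𝟙 ⌊ vE G (enter l) ≟ y ⌋ - 𝟙 ⌊ w ≟ y ⌋) +ℚ 0ℚ) (vE-leave l) ⟩
      (𝟙 ⌊ vE G (enter l) ≟ y ⌋ - 𝟙 ⌊ vE G (enter l) ≟ y ⌋) +ℚ 0ℚ
        ≡⟨ trans (ℚ.+-identityʳ _) (ℚ.+-inverseʳ (𝟙 ⌊ vE G (enter l) ≟ y ⌋)) ⟩
      0ℚ
        ∎
      where open ≡-Reasoning

    direction-supported : ∀ l c a → ¬ (0ℚ < x a) → direction l c a ≡ 0ℚ
    direction-supported l zero a _ = refl
    direction-supported l (suc c) a x≯0 =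
      cong₂ _+ℚ_ (cong₂ _-_ (χ-off (off (proj₁ (enter-fractional l)))) (χ-off (off (proj₁ (leave-fractional l)))))
                 (direction-supported (next l) c a x≯0)
      where
      off : ∀ {e} → 0ℚ < x e → e ≢ a
      off 0<xₑ refl = x≯0 0<xₑ

    direction-nonpos : ∀ l c a → (∀ k → k ℕ.< c → enter (walk l k) ≢ a) → direction l c a ≤ 0ℚ
    direction-nonpos l zero a _ = ℚ.≤-refl
    direction-nonpos l (suc c) a fresh = begin
      (χ (enter l) a - χ (leave l) a) +ℚ direction (next l) c a
        ≡⟨ cong (λ q → (q - χ (leave l) a) +ℚ direction (next l) c a) (χ-off (fresh 0 (s≤s z≤n))) ⟩
      (0ℚ - χ (leave l) a) +ℚ direction (next l) c a
        ≤⟨ ℚ.+-mono-≤ (ℚ.≤-trans (ℚ.≤-reflexive (ℚ.+-identityˡ _)) (ℚ.neg-antimono-≤ (𝟙-nonneg ⌊ leave l ≟ a ⌋)))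
                      (direction-nonpos (next l) c a (λ k k<c → fresh (suc k) (s≤s k<c))) ⟩
      0ℚ ∎
      where open ℚ.≤-Reasoning

    balancedDirection : ∀ f₀ → Fractional x f₀ → BalancedDirection x
    balancedDirection f₀ f₀-frac = fromRepeat (firstRepeat (source ∘ walk start))
      where
      start : Link
      start = linkFrom f₀ f₀-frac
      fromRepeat : (∃₂ λ i c → source (walk start i) ≡ source (walk start (i + suc c)) ×
                     (∀ {a b} → a ℕ.< b → b ℕ.≤ c → source (walk start (i + a)) ≢ source (walk start (i + b)))) → BalancedDirection x
      fromRepeat (i , c , returns , window) = record
        { d = direction l₀ (suc c)
        ; balancedU = λ y → trans (direction-balancedU y l₀ (suc c)) (closes y)
        ; balancedV = λ y → direction-balancedV y l₀ (suc c)
        ; supported = direction-supported l₀ (suc c)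
        ; decreasing = leave l₀ , negative
        }
        where
        l₀ : Link
        l₀ = walk start i
        source-walk : ∀ k → source (walk l₀ k) ≡ source (walk start (i + k))
        source-walk k = cong source (sym (walk-+ start i k))
        closes : ∀ y → 𝟙 ⌊ source l₀ ≟ y ⌋ - 𝟙 ⌊ source (walk l₀ (suc c)) ≟ y ⌋ ≡ 0ℚ
        closes y = trans (cong (λ w → 𝟙 ⌊ source l₀ ≟ y ⌋ - 𝟙 ⌊ w ≟ y ⌋) (trans (source-walk (suc c)) (sym returns)))
                         (ℚ.+-inverseʳ (𝟙 ⌊ source l₀ ≟ y ⌋))
        fresh : ∀ k → k ℕ.< c → enter (walk (next l₀) k) ≢ leave l₀
        fresh zero    _          = enter-next≢leave l₀
        fresh (suc k) (s≤s k<c) same = window (s≤s (s≤s z≤n)) (s≤s k<c) (begin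
          source (walk start (i + 1))        ≡⟨ source-walk 1 ⟨
          source (next l₀)                   ≡⟨ uE-enter-next l₀ ⟩
          uE G (leave l₀)                    ≡⟨ cong (uE G) same ⟨
          source (walk l₀ (suc (suc k)))     ≡⟨ source-walk (suc (suc k)) ⟩
          source (walk start (i + suc (suc k))) ∎)
          where open ≡-Reasoning
        negative : direction l₀ (suc c) (leave l₀) < 0ℚ
        negative = begin-strict
          (χ (enter l₀) (leave l₀) - χ (leave l₀) (leave l₀)) +ℚ direction (next l₀) c (leave l₀)
            ≡⟨ cong₂ (λ p q → (p - q) +ℚ direction (next l₀) c (leave l₀))
                     (χ-off (leave≢enter l₀ ∘ sym)) (cong 𝟙 (⌊⌋-true (leave l₀ ≟ leave l₀) refl)) ⟩
          (0ℚ - 1ℚ) +ℚ direction (next l₀) c (leave l₀)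
            ≤⟨ ℚ.+-monoʳ-≤ (0ℚ - 1ℚ) (direction-nonpos (next l₀) c (leave l₀) fresh) ⟩
          (0ℚ - 1ℚ) +ℚ 0ℚ
            <⟨ ℚ.negative⁻¹ ((0ℚ - 1ℚ) +ℚ 0ℚ) ⟩
          0ℚ ∎
          where open ℚ.≤-Reasoning

  module _ {x : Fin E → ℚ} (fpm : IsFractionalPM x) where

    private
      x≥0 : ∀ e → 0ℚ ≤ x e
      x≥0 = proj₂ (proj₂ fpm)

    integralPM : (∀ e → ¬ Fractional x e) → PerfectMatchingWithin x
    integralPM integral = record { edgeAt = edgeAt ; uE-edgeAt = uE-edgeAt ; vE-edgeAt-injective = injective } , positive-edgeAt
      where
      positiveAt : ∀ u → ∃ λ e → incU G u e ≡ true × 0ℚ < x e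
      positiveAt u = Star.positiveEdge x x≥0 (incU G u) (proj₁ fpm u)
      edgeAt : Fin n → Fin E
      edgeAt u = proj₁ (positiveAt u)
      uE-edgeAt : ∀ u → uE G (edgeAt u) ≡ u
      uE-edgeAt u = ⌊⌋-true⁻ (_ ≟ u) (proj₁ (proj₂ (positiveAt u)))
      positive-edgeAt : ∀ u → 0ℚ < x (edgeAt u)
      positive-edgeAt u = proj₂ (proj₂ (positiveAt u))
      atLeast1 : ∀ u → 1ℚ ≤ x (edgeAt u)
      atLeast1 u = ℚ.≮⇒≥ (λ x<1 → integral (edgeAt u) (positive-edgeAt u , x<1))
      injective : ∀ {a b} → vE G (edgeAt a) ≡ vE G (edgeAt b) → a ≡ b
      injective {a} {b} same-v = decide (edgeAt a ≟ edgeAt b)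
        where
        decide : Dec (edgeAt a ≡ edgeAt b) → a ≡ b
        decide (yes same) = trans (sym (uE-edgeAt a)) (trans (cong (uE G) same) (uE-edgeAt b))
        decide (no differ) = ⊥-elim (ℚ.<-irrefl refl (ℚ.<-≤-trans below1 (atLeast1 b)))
          where
          v : Fin n
          v = vE G (edgeAt b)
          below1 : x (edgeAt b) < 1ℚ
          below1 = Star.othersBelow1 x x≥0 (incV G v) (proj₁ (proj₂ fpm) v)
                     (⌊⌋-true (_ ≟ v) same-v) (⌊⌋-true (v ≟ v) refl) differ (positive-edgeAt a)

  fractionalPM⇒PM : ∀ {x} → IsFractionalPM x → PerfectMatchingWithin x
  fractionalPM⇒PM {x} fpm = go fpm (ℕ.<-wellFounded (support x))
    where
    go : ∀ {x} → IsFractionalPM x → Acc ℕ._<_ (support x) → PerfectMatchingWithin x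
    go {x} fpm (acc smaller) = split (any? (λ e → (0ℚ ℚ.<? x e) ×-dec (x e ℚ.<? 1ℚ)))
      where
      split : Dec (∃ (Fractional x)) → PerfectMatchingWithin x
      split (no integral) = integralPM fpm (λ e frac → integral (e , frac))
      split (yes (f₀ , frac)) = recurse (cancel fpm (AlternatingWalk.balancedDirection fpm f₀ frac))
        where
        recurse : SmallerFractionalPM x → PerfectMatchingWithin x
        recurse (x′ , fpm′ , shrinks , fewer) with go fpm′ (smaller fewer)
        ... | P , positive = P , λ u → shrinks _ (positive u)

-- Circulations: a potential or an odd closed walk

xorList : List Bool → Bool
xorList []       = false
xorList (b ∷ bs) = b xor xorList bs

xorList-map-xor : ∀ {A : Set} (f g : A → Bool) xs → xorList (map (λ a → f a xor g a) xs) ≡ xorList (map f xs) xor xorList (map g xs)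
xorList-map-xor f g []       = refl
xorList-map-xor f g (a ∷ xs) = trans (cong ((f a xor g a) xor_) (xorList-map-xor f g xs)) (xor-interchange (f a) (g a) _ _)

unique-map-injective : ∀ {A B : Set} (f : A → B) {xs} → Unique (map f xs) → ∀ {a b} → a ∈ xs → b ∈ xs → f a ≡ f b → a ≡ b
unique-map-injective f {_ ∷ _} (fresh ∷ _)      (here refl) (here refl) _  = refl
unique-map-injective f {_ ∷ _} (fresh ∷ _)      (here refl) (there b∈)  eq = contradiction eq (All.lookup fresh (∈-map⁺ f b∈))
unique-map-injective f {_ ∷ _} (fresh ∷ _)      (there a∈)  (here refl) eq = contradiction (sym eq) (All.lookup fresh (∈-map⁺ f a∈))
unique-map-injective f {_ ∷ _} (_     ∷ unique) (there a∈)  (there b∈)  eq = unique-map-injective f unique a∈ b∈ eq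

keep-2-3 : ∀ a b c d → a ≡ 0ℚ → d ≡ 0ℚ → a +ℚ (b +ℚ (c +ℚ d)) ≡ b +ℚ c
keep-2-3 a b c d refl refl = trans (ℚ.+-identityˡ _) (cong (b +ℚ_) (ℚ.+-identityʳ c))

keep-2-4 : ∀ a b c d → a ≡ 0ℚ → c ≡ 0ℚ → a +ℚ (b +ℚ (c +ℚ d)) ≡ b +ℚ d
keep-2-4 a b c d refl refl = trans (ℚ.+-identityˡ _) (cong (b +ℚ_) (ℚ.+-identityˡ d))

keep-1-3 : ∀ a b c d → b ≡ 0ℚ → d ≡ 0ℚ → a +ℚ (b +ℚ (c +ℚ d)) ≡ a +ℚ c
keep-1-3 a b c d refl refl = cong (a +ℚ_) (trans (ℚ.+-identityˡ _) (ℚ.+-identityʳ c))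

keep-1-4 : ∀ a b c d → b ≡ 0ℚ → c ≡ 0ℚ → a +ℚ (b +ℚ (c +ℚ d)) ≡ a +ℚ d
keep-1-4 a b c d refl refl = cong (a +ℚ_) (trans (ℚ.+-identityˡ _) (ℚ.+-identityˡ d))

sumList : ∀ {X : Set} → (X → ℚ) → List X → ℚ
sumList f []       = 0ℚ
sumList f (a ∷ as) = f a +ℚ sumList f as

module _ {X : Set} where

  sumList-cong : ∀ {f g : X → ℚ} (as : List X) → (∀ a → f a ≡ g a) → sumList f as ≡ sumList g as
  sumList-cong []       eq = refl
  sumList-cong (a ∷ as) eq = cong₂ _+ℚ_ (eq a) (sumList-cong as eq)

  sumList-zero : ∀ {f : X → ℚ} (as : List X) → (∀ a → f a ≡ 0ℚ) → sumList f as ≡ 0ℚ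
  sumList-zero []       eq = refl
  sumList-zero (a ∷ as) eq = trans (cong₂ _+ℚ_ (eq a) (sumList-zero as eq)) (ℚ.+-identityˡ 0ℚ)

  sumList-++ : ∀ (f : X → ℚ) as bs → sumList f (as ++ bs) ≡ sumList f as +ℚ sumList f bs
  sumList-++ f []       bs = sym (ℚ.+-identityˡ _)
  sumList-++ f (a ∷ as) bs = trans (cong (f a +ℚ_) (sumList-++ f as bs)) (sym (ℚ.+-assoc (f a) _ _))

  sumList-*ˡ : ∀ c (f : X → ℚ) as → sumList (λ a → c * f a) as ≡ c * sumList f as
  sumList-*ˡ c f []       = sym (ℚ.*-zeroʳ c)
  sumList-*ˡ c f (a ∷ as) = trans (cong (c * f a +ℚ_) (sumList-*ˡ c f as)) (sym (ℚ.*-distribˡ-+ c _ _))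

  sumList-*ʳ : ∀ c (f : X → ℚ) as → sumList (λ a → f a * c) as ≡ sumList f as * c
  sumList-*ʳ c f as = trans (sumList-cong as (λ a → ℚ.*-comm (f a) c)) (trans (sumList-*ˡ c f as) (ℚ.*-comm c _))

  sumList-pos : ∀ {f : X → ℚ} → (∀ a → 0ℚ < f a) → ∀ a as → 0ℚ < sumList f (a ∷ as)
  sumList-pos {f} pos a as = ℚ.<-≤-trans (pos a) (ℚ.≤-trans (ℚ.≤-reflexive (sym (ℚ.+-identityʳ (f a)))) (ℚ.+-monoʳ-≤ (f a) (nonneg as)))
    where
    nonneg : ∀ as → 0ℚ ≤ sumList f as
    nonneg []       = ℚ.≤-refl
    nonneg (a ∷ as) = ℚ.+-mono-≤ (ℚ.<⇒≤ (pos a)) (nonneg as)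

sumList-map : ∀ {X Y : Set} (f : Y → ℚ) (g : X → Y) as → sumList f (map g as) ≡ sumList (f ∘ g) as
sumList-map f g []       = refl
sumList-map f g (a ∷ as) = cong (f (g a) +ℚ_) (sumList-map f g as)

module Walks {n : ℕ} {Edge : Set} (src tgt : Edge → Fin n) (label : Edge → Bool) where

  infixr 5 _∷_ _++ʷ_

  data Walk : Fin n → Fin n → Set where
    []  : ∀ {a} → Walk a a
    _∷_ : ∀ {b} (e : Edge) → Walk (tgt e) b → Walk (src e) b

  weight : ∀ {a b} → Walk a b → Bool
  weight []      = false
  weight (e ∷ w) = label e xor weight w

  _++ʷ_ : ∀ {a b c} → Walk a b → Walk b c → Walk a c
  []      ++ʷ w′ = w′
  (e ∷ w) ++ʷ w′ = e ∷ (w ++ʷ w′)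

  weight-++ : ∀ {a b c} (w : Walk a b) (w′ : Walk b c) → weight (w ++ʷ w′) ≡ weight w xor weight w′
  weight-++ []      w′ = refl
  weight-++ (e ∷ w) w′ = trans (cong (label e xor_) (weight-++ w w′)) (sym (xor-assoc (label e) (weight w) (weight w′)))

  OddClosedWalk : Set
  OddClosedWalk = ∃₂ λ a b → Σ (Walk a b) λ w → a ≡ b × weight w ≡ true

  -- An arc of a reduced system remembers the walk of the original graph it stands for.
  record Arc : Set where
    constructor arc
    field
      tail head : Fin n
      route     : Walk tail head
      flow      : ℚ
      flow-pos  : 0ℚ < flow
  open Arc public

  outflow inflow : Fin n → Arc → ℚ
  outflow y a = if ⌊ tail a ≟ y ⌋ then flow a else 0ℚ
  inflow  y a = if ⌊ head a ≟ y ⌋ then flow a else 0ℚ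

  IsCirculation : List Arc → Set
  IsCirculation A = ∀ y → sumList (outflow y) A ≡ sumList (inflow y) A

  Consistent : (Fin n → Bool) → Arc → Set
  Consistent p a = p (tail a) xor p (head a) ≡ weight (route a)

  HasPotential : List Arc → Set
  HasPotential A = ∃ λ p → All (Consistent p) A

  weight-subst : ∀ {a a′ b} (eq : a ≡ a′) (w : Walk a b) → weight (subst (λ v → Walk v b) eq w) ≡ weight w
  weight-subst refl w = refl

  outflow-on : ∀ {y} a → tail a ≡ y → outflow y a ≡ flow a
  outflow-on {y} a eq = cong (λ b → if b then flow a else 0ℚ) (⌊⌋-true (tail a ≟ y) eq)

  outflow-off : ∀ {y} a → tail a ≢ y → outflow y a ≡ 0ℚ
  outflow-off {y} a neq = cong (λ b → if b then flow a else 0ℚ) (⌊⌋-false (tail a ≟ y) neq)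

  inflow-on : ∀ {y} a → head a ≡ y → inflow y a ≡ flow a
  inflow-on {y} a eq = cong (λ b → if b then flow a else 0ℚ) (⌊⌋-true (head a ≟ y) eq)

  inflow-off : ∀ {y} a → head a ≢ y → inflow y a ≡ 0ℚ
  inflow-off {y} a neq = cong (λ b → if b then flow a else 0ℚ) (⌊⌋-false (head a ≟ y) neq)

  Within : (Fin n → Set) → Arc → Set
  Within V a = V (tail a) × V (head a)

  module Eliminate (z : Fin n) where

    Avoiding Looping Entering Leaving : Arc → Set
    Avoiding a = tail a ≢ z × head a ≢ z
    Looping  a = tail a ≡ z × head a ≡ z
    Entering a = tail a ≢ z × head a ≡ z
    Leaving  a = tail a ≡ z × head a ≢ z

    data Classified : Set where
      classified : List (Σ Arc Avoiding) → List (Σ Arc Looping) → List (Σ Arc Entering) → List (Σ Arc Leaving) → Classified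

    insert : (a : Arc) → Dec (tail a ≡ z) → Dec (head a ≡ z) → Classified → Classified
    insert a (no t≢z)  (no h≢z)  (classified R L I O) = classified ((a , t≢z , h≢z) ∷ R) L I O
    insert a (yes t≡z) (yes h≡z) (classified R L I O) = classified R ((a , t≡z , h≡z) ∷ L) I O
    insert a (no t≢z)  (yes h≡z) (classified R L I O) = classified R L ((a , t≢z , h≡z) ∷ I) O
    insert a (yes t≡z) (no h≢z)  (classified R L I O) = classified R L I ((a , t≡z , h≢z) ∷ O)

    classify : List Arc → Classified
    classify []      = classified [] [] [] []
    classify (a ∷ A) = insert a (tail a ≟ z) (head a ≟ z) (classify A)

    sumOf : ∀ {P : Arc → Set} → (Arc → ℚ) → List (Σ Arc P) → ℚ
    sumOf g = sumList (g ∘ proj₁)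

    AllOf : ∀ {P : Arc → Set} → (Arc → Set) → List (Σ Arc P) → Set
    AllOf Q = All (Q ∘ proj₁)

    sumClassified : (Arc → ℚ) → Classified → ℚ
    sumClassified g (classified R L I O) = sumOf g R +ℚ (sumOf g L +ℚ (sumOf g I +ℚ sumOf g O))

    AllClassified : (Arc → Set) → Classified → Set
    AllClassified Q (classified R L I O) = AllOf Q R × AllOf Q L × AllOf Q I × AllOf Q O

    sum-insert : ∀ g a t? h? s → g a +ℚ sumClassified g s ≡ sumClassified g (insert a t? h? s)
    sum-insert g a (no _)  (no _)  (classified R L I O) = sym (ℚ.+-assoc (g a) (sumOf g R) _)
    sum-insert g a (yes _) (yes _) (classified R L I O) =
      trans (ℚ+.x∙yz≈y∙xz (g a) (sumOf g R) _) (cong (sumOf g R +ℚ_) (sym (ℚ.+-assoc (g a) (sumOf g L) _)))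
    sum-insert g a (no _)  (yes _) (classified R L I O) =
      trans (ℚ+.x∙yz≈y∙xz (g a) (sumOf g R) _) (cong (sumOf g R +ℚ_)
        (trans (ℚ+.x∙yz≈y∙xz (g a) (sumOf g L) _) (cong (sumOf g L +ℚ_) (sym (ℚ.+-assoc (g a) (sumOf g I) _)))))
    sum-insert g a (yes _) (no _)  (classified R L I O) =
      trans (ℚ+.x∙yz≈y∙xz (g a) (sumOf g R) _) (cong (sumOf g R +ℚ_)
        (trans (ℚ+.x∙yz≈y∙xz (g a) (sumOf g L) _) (cong (sumOf g L +ℚ_) (ℚ+.x∙yz≈y∙xz (g a) (sumOf g I) (sumOf g O)))))

    sum-classify : ∀ g A → sumList g A ≡ sumClassified g (classify A)
    sum-classify g []      = sym (trans (ℚ.+-identityˡ _) (trans (ℚ.+-identityˡ _) (ℚ.+-identityˡ _)))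
    sum-classify g (a ∷ A) = trans (cong (g a +ℚ_) (sum-classify g A)) (sum-insert g a (tail a ≟ z) (head a ≟ z) (classify A))

    all-insert⁺ : ∀ {Q} a t? h? s → Q a → AllClassified Q s → AllClassified Q (insert a t? h? s)
    all-insert⁺ a (no _)  (no _)  (classified R L I O) qa (qR , qL , qI , qO) = qa ∷ qR , qL , qI , qO
    all-insert⁺ a (yes _) (yes _) (classified R L I O) qa (qR , qL , qI , qO) = qR , qa ∷ qL , qI , qO
    all-insert⁺ a (no _)  (yes _) (classified R L I O) qa (qR , qL , qI , qO) = qR , qL , qa ∷ qI , qO
    all-insert⁺ a (yes _) (no _)  (classified R L I O) qa (qR , qL , qI , qO) = qR , qL , qI , qa ∷ qO

    all-insert⁻ : ∀ {Q} a t? h? s → AllClassified Q (insert a t? h? s) → Q a × AllClassified Q s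
    all-insert⁻ a (no _)  (no _)  (classified R L I O) (qa ∷ qR , qL , qI , qO) = qa , qR , qL , qI , qO
    all-insert⁻ a (yes _) (yes _) (classified R L I O) (qR , qa ∷ qL , qI , qO) = qa , qR , qL , qI , qO
    all-insert⁻ a (no _)  (yes _) (classified R L I O) (qR , qL , qa ∷ qI , qO) = qa , qR , qL , qI , qO
    all-insert⁻ a (yes _) (no _)  (classified R L I O) (qR , qL , qI , qa ∷ qO) = qa , qR , qL , qI , qO

    all-classify⁺ : ∀ {Q} A → All Q A → AllClassified Q (classify A)
    all-classify⁺ []      []         = [] , [] , [] , []
    all-classify⁺ (a ∷ A) (qa ∷ qA) = all-insert⁺ a (tail a ≟ z) (head a ≟ z) (classify A) qa (all-classify⁺ A qA)

    all-classify⁻ : ∀ {Q} A → AllClassified Q (classify A) → All Q A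
    all-classify⁻ []      _ = []
    all-classify⁻ (a ∷ A) q with all-insert⁻ a (tail a ≟ z) (head a ≟ z) (classify A) q
    ... | qa , qA = qa ∷ all-classify⁻ A qA

    shortcutRoute : (a : Σ Arc Entering) (b : Σ Arc Leaving) → Walk (tail (proj₁ a)) (head (proj₁ b))
    shortcutRoute (a , _ , h≡z) (b , t≡z , _) = route a ++ʷ subst (λ v → Walk v (head b)) (trans t≡z (sym h≡z)) (route b)

    weight-shortcutRoute : ∀ a b → weight (shortcutRoute a b) ≡ weight (route (proj₁ a)) xor weight (route (proj₁ b))
    weight-shortcutRoute (a , _ , h≡z) (b , t≡z , _) =
      trans (weight-++ (route a) _) (cong (weight (route a) xor_) (weight-subst (trans t≡z (sym h≡z)) (route b)))

    -- Eliminating z chains every arc a entering z with every arc b leaving it, with flow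
    -- f(a) f(b) / T for T the flow through z; the flow stays balanced at every other vertex.
    module Shortcuts (T : ℚ) (T>0 : 0ℚ < T) where

      instance
        T≢0 : NonZero T
        T≢0 = ℚ.pos⇒nonZero T {{positive T>0}}

      shortcut : Σ Arc Entering → Σ Arc Leaving → Arc
      shortcut ia@(a , _) ob@(b , _) = arc (tail a) (head b) (shortcutRoute ia ob) ((flow a * flow b) ÷ T) positive-flow
        where
        positive-flow : 0ℚ < (flow a * flow b) ÷ T
        positive-flow = ℚ.positive⁻¹ _
          {{ℚ.pos*pos⇒pos (flow a * flow b) {{ℚ.pos*pos⇒pos (flow a) {{positive (flow-pos a)}} (flow b) {{positive (flow-pos b)}}}}
                                                        (1/ T) {{ℚ.1/pos⇒pos T {{positive T>0}}}}}}

      shortcuts : List (Σ Arc Entering) → List (Σ Arc Leaving) → List Arc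
      shortcuts = cartesianProductWith shortcut

      sumList-shortcuts : ∀ (g : Arc → ℚ) I O → sumList g (shortcuts I O) ≡ sumList (λ a → sumList (λ b → g (shortcut a b)) O) I
      sumList-shortcuts g []      O = refl
      sumList-shortcuts g (a ∷ I) O =
        trans (sumList-++ g (map (shortcut a) O) (shortcuts I O)) (cong₂ _+ℚ_ (sumList-map g (shortcut a) O) (sumList-shortcuts g I O))

      normalised : ∀ {S} → S ≡ T → S * 1/ T ≡ 1ℚ
      normalised total = trans (cong (_* 1/ T) total) (ℚ.*-inverseʳ T)

      outflow-shortcuts : ∀ I O → sumOf flow O ≡ T → ∀ y → sumList (outflow y) (shortcuts I O) ≡ sumOf (outflow y) I
      outflow-shortcuts I O total y = trans (sumList-shortcuts (outflow y) I O) (sumList-cong I per-entering)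
        where
        per-entering : ∀ a → sumList (λ b → outflow y (shortcut a b)) O ≡ outflow y (proj₁ a)
        per-entering ia@(a , _) = begin
          sumList (λ b → outflow y (shortcut ia b)) O
            ≡⟨ sumList-cong O (λ b → trans (cong (λ q → if ⌊ tail a ≟ y ⌋ then q else 0ℚ) (ℚ.*-assoc (flow a) (flow (proj₁ b)) (1/ T)))
                                           (if-*ʳ ⌊ tail a ≟ y ⌋ (flow a) (flow (proj₁ b) * 1/ T))) ⟩
          sumList (λ b → outflow y a * (flow (proj₁ b) * 1/ T)) O
            ≡⟨ sumList-*ˡ (outflow y a) (λ b → flow (proj₁ b) * 1/ T) O ⟩
          outflow y a * sumList (λ b → flow (proj₁ b) * 1/ T) O
            ≡⟨ cong (outflow y a *_) (trans (sumList-*ʳ (1/ T) (flow ∘ proj₁) O) (normalised total)) ⟩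
          outflow y a * 1ℚ
            ≡⟨ ℚ.*-identityʳ (outflow y a) ⟩
          outflow y a ∎
          where open ≡-Reasoning

      inflow-shortcuts : ∀ I O → sumOf flow I ≡ T → ∀ y → sumList (inflow y) (shortcuts I O) ≡ sumOf (inflow y) O
      inflow-shortcuts I O total y = begin
        sumList (inflow y) (shortcuts I O)
          ≡⟨ sumList-shortcuts (inflow y) I O ⟩
        sumList (λ a → sumList (λ b → inflow y (shortcut a b)) O) I
          ≡⟨ sumList-cong I (λ a → trans (sumList-cong O (per-pair a)) (sumList-*ˡ (flow (proj₁ a) * 1/ T) (inflow y ∘ proj₁) O)) ⟩
        sumList (λ a → (flow (proj₁ a) * 1/ T) * sumOf (inflow y) O) I
          ≡⟨ sumList-*ʳ (sumOf (inflow y) O) (λ a → flow (proj₁ a) * 1/ T) I ⟩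
        sumList (λ a → flow (proj₁ a) * 1/ T) I * sumOf (inflow y) O
          ≡⟨ cong (_* sumOf (inflow y) O) (trans (sumList-*ʳ (1/ T) (flow ∘ proj₁) I) (normalised total)) ⟩
        1ℚ * sumOf (inflow y) O
          ≡⟨ ℚ.*-identityˡ _ ⟩
        sumOf (inflow y) O ∎
        where
        open ≡-Reasoning
        per-pair : ∀ a b → inflow y (shortcut a b) ≡ (flow (proj₁ a) * 1/ T) * inflow y (proj₁ b)
        per-pair (a , _) (b , _) =
          trans (cong (λ q → if ⌊ head b ≟ y ⌋ then q else 0ℚ) (ℚ*.xy∙z≈xz∙y (flow a) (flow b) (1/ T)))
                (if-*ˡ ⌊ head b ≟ y ⌋ (flow a * 1/ T) (flow b))

    HasPotentialOn : Classified → Set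
    HasPotentialOn s = ∃ λ p → AllClassified (Consistent p) s

    assign : (Fin n → Bool) → Bool → Fin n → Bool
    assign p b y = if ⌊ y ≟ z ⌋ then b else p y

    assign-at : ∀ p b {y} → y ≡ z → assign p b y ≡ b
    assign-at p b {y} eq = cong (λ c → if c then b else p y) (⌊⌋-true (y ≟ z) eq)

    assign-off : ∀ p b {y} → y ≢ z → assign p b y ≡ p y
    assign-off p b {y} neq = cong (λ c → if c then b else p y) (⌊⌋-false (y ≟ z) neq)

    avoiding-consistent : ∀ p b (r : Σ Arc Avoiding) → Consistent p (proj₁ r) → Consistent (assign p b) (proj₁ r)
    avoiding-consistent p b (a , t≢z , h≢z) c = trans (cong₂ _xor_ (assign-off p b t≢z) (assign-off p b h≢z)) c

    even-loop-consistent : ∀ p (l : Σ Arc Looping) → weight (route (proj₁ l)) ≡ false → Consistent p (proj₁ l)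
    even-loop-consistent p (a , t≡z , h≡z) even = trans (cong₂ (λ u v → p u xor p v) t≡z h≡z) (trans (xor-same (p z)) (sym even))

    findOddLoop : (L : List (Σ Arc Looping)) → OddClosedWalk ⊎ All (λ l → weight (route (proj₁ l)) ≡ false) L
    findOddLoop [] = inj₂ []
    findOddLoop ((a , t≡z , h≡z) ∷ L) with weight (route a) in w
    ... | true  = inj₁ (tail a , head a , route a , trans t≡z (sym h≡z) , w)
    ... | false with findOddLoop L
    ...   | inj₁ odd  = inj₁ odd
    ...   | inj₂ even = inj₂ (w ∷ even)

    module Balance (R : List (Σ Arc Avoiding)) (L : List (Σ Arc Looping)) (I : List (Σ Arc Entering)) (O : List (Σ Arc Leaving))
                   (balanced : ∀ y → sumClassified (outflow y) (classified R L I O) ≡ sumClassified (inflow y) (classified R L I O)) where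

      private
        F : ∀ {P : Arc → Set} → List (Σ Arc P) → ℚ
        F = sumOf flow

        outflow-zero : ∀ {P : Arc → Set} {y} (X : List (Σ Arc P)) → (∀ x → tail (proj₁ x) ≢ y) → sumOf (outflow y) X ≡ 0ℚ
        outflow-zero X off = sumList-zero X (λ x → outflow-off (proj₁ x) (off x))

        inflow-zero : ∀ {P : Arc → Set} {y} (X : List (Σ Arc P)) → (∀ x → head (proj₁ x) ≢ y) → sumOf (inflow y) X ≡ 0ℚ
        inflow-zero X off = sumList-zero X (λ x → inflow-off (proj₁ x) (off x))

        outflow-full : ∀ {P : Arc → Set} {y} (X : List (Σ Arc P)) → (∀ x → tail (proj₁ x) ≡ y) → sumOf (outflow y) X ≡ F X
        outflow-full X on = sumList-cong X (λ x → outflow-on (proj₁ x) (on x))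

        inflow-full : ∀ {P : Arc → Set} {y} (X : List (Σ Arc P)) → (∀ x → head (proj₁ x) ≡ y) → sumOf (inflow y) X ≡ F X
        inflow-full X on = sumList-cong X (λ x → inflow-on (proj₁ x) (on x))

      flow-entering≡leaving : F I ≡ F O
      flow-entering≡leaving = ℚ-group.∙-cancelˡ (F L) (F I) (F O) (begin
        F L +ℚ F I
          ≡⟨ cong₂ _+ℚ_ (inflow-full L (proj₂ ∘ proj₂)) (inflow-full I (proj₂ ∘ proj₂)) ⟨
        sumOf (inflow z) L +ℚ sumOf (inflow z) I
          ≡⟨ keep-2-3 _ (sumOf (inflow z) L) (sumOf (inflow z) I) _ (inflow-zero R (proj₂ ∘ proj₂)) (inflow-zero O (proj₂ ∘ proj₂)) ⟨
        sumClassified (inflow z) (classified R L I O)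
          ≡⟨ balanced z ⟨
        sumClassified (outflow z) (classified R L I O)
          ≡⟨ keep-2-4 _ (sumOf (outflow z) L) _ (sumOf (outflow z) O) (outflow-zero R (proj₁ ∘ proj₂)) (outflow-zero I (proj₁ ∘ proj₂)) ⟩
        sumOf (outflow z) L +ℚ sumOf (outflow z) O
          ≡⟨ cong₂ _+ℚ_ (outflow-full L (proj₁ ∘ proj₂)) (outflow-full O (proj₁ ∘ proj₂)) ⟩
        F L +ℚ F O ∎)
        where open ≡-Reasoning

      conserved : ∀ y → sumOf (outflow y) R +ℚ sumOf (outflow y) I ≡ sumOf (inflow y) R +ℚ sumOf (inflow y) O
      conserved y = decide (y ≟ z)
        where
        decide : Dec (y ≡ z) → sumOf (outflow y) R +ℚ sumOf (outflow y) I ≡ sumOf (inflow y) R +ℚ sumOf (inflow y) O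
        decide (yes refl) = cong₂ _+ℚ_ (trans (outflow-zero R (proj₁ ∘ proj₂)) (sym (inflow-zero R (proj₂ ∘ proj₂))))
                                       (trans (outflow-zero I (proj₁ ∘ proj₂)) (sym (inflow-zero O (proj₂ ∘ proj₂))))
        decide (no y≢z) = begin
          sumOf (outflow y) R +ℚ sumOf (outflow y) I
            ≡⟨ keep-1-3 (sumOf (outflow y) R) _ (sumOf (outflow y) I) _
                        (outflow-zero L (at-z ∘ proj₁ ∘ proj₂)) (outflow-zero O (at-z ∘ proj₁ ∘ proj₂)) ⟨
          sumClassified (outflow y) (classified R L I O)
            ≡⟨ balanced y ⟩
          sumClassified (inflow y) (classified R L I O)
            ≡⟨ keep-1-4 (sumOf (inflow y) R) _ _ (sumOf (inflow y) O)
                        (inflow-zero L (at-z ∘ proj₂ ∘ proj₂)) (inflow-zero I (at-z ∘ proj₂ ∘ proj₂)) ⟩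
          sumOf (inflow y) R +ℚ sumOf (inflow y) O ∎
          where
          open ≡-Reasoning
          at-z : ∀ {v} → v ≡ z → v ≢ y
          at-z v≡z v≡y = y≢z (trans (sym v≡y) v≡z)

    ShortcutConsistent : (Fin n → Bool) → Σ Arc Entering → Σ Arc Leaving → Set
    ShortcutConsistent p a b = p (tail (proj₁ a)) xor p (head (proj₁ b)) ≡ weight (shortcutRoute a b)

    extendAt : (Fin n → Bool) → Σ Arc Entering → Fin n → Bool
    extendAt p (a₀ , _) = assign p (p (tail a₀) xor weight (route a₀))

    entering-consistent : ∀ p a₀ b₀ (a : Σ Arc Entering) → ShortcutConsistent p a b₀ → ShortcutConsistent p a₀ b₀ →
                          Consistent (extendAt p a₀) (proj₁ a)
    entering-consistent p a₀ b₀ ia@(a , t≢z , h≡z) c c₀ =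
      trans (cong₂ _xor_ (assign-off p _ t≢z) (assign-at p _ h≡z))
            (xor-through (p (tail a)) (p (tail (proj₁ a₀))) (p (head (proj₁ b₀)))
                         (weight (route a)) (weight (route (proj₁ a₀))) (weight (route (proj₁ b₀)))
                         (trans c (weight-shortcutRoute ia b₀)) (trans c₀ (weight-shortcutRoute a₀ b₀)))

    leaving-consistent : ∀ p a₀ (b : Σ Arc Leaving) → ShortcutConsistent p a₀ b → Consistent (extendAt p a₀) (proj₁ b)
    leaving-consistent p a₀ ob@(b , t≡z , h≢z) c =
      trans (cong₂ _xor_ (assign-at p _ t≡z) (assign-off p _ h≢z))
            (xor-across (p (tail (proj₁ a₀))) (p (head b)) (weight (route (proj₁ a₀))) (weight (route b))
                        (trans c (weight-shortcutRoute a₀ ob)))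

    module Reduce {V V′ : Fin n → Set} (shrink : ∀ {y} → V y → y ≢ z → V′ y)
                  (recurse : (A′ : List Arc) → All (Within V′) A′ → IsCirculation A′ → HasPotential A′ ⊎ OddClosedWalk)
                  (R : List (Σ Arc Avoiding)) (inside-R : AllOf (Within V) R) where

      ConsistentOn : (Fin n → Bool) → List (Σ Arc Entering) → List (Σ Arc Leaving) → Set
      ConsistentOn p I O = AllOf (Consistent p) R × AllOf (Consistent p) I × AllOf (Consistent p) O

      avoiding-inside : All (Within V′) (map proj₁ R)
      avoiding-inside = All.map⁺ (All.map (λ {r} → shrink-avoiding r) inside-R)
        where
        shrink-avoiding : (r : Σ Arc Avoiding) → Within V (proj₁ r) → Within V′ (proj₁ r)
        shrink-avoiding (a , t≢z , h≢z) (t , h) = shrink t t≢z , shrink h h≢z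

      extend : (I : List (Σ Arc Entering)) (O : List (Σ Arc Leaving)) → AllOf (Within V) I → AllOf (Within V) O →
               sumOf flow I ≡ sumOf flow O →
               (∀ y → sumOf (outflow y) R +ℚ sumOf (outflow y) I ≡ sumOf (inflow y) R +ℚ sumOf (inflow y) O) →
               (∃ λ p → ConsistentOn p I O) ⊎ OddClosedWalk
      extend [] [] _ _ _ conserved = lift (recurse (map proj₁ R) avoiding-inside circulation)
        where
        circulation : IsCirculation (map proj₁ R)
        circulation y = begin
          sumList (outflow y) (map proj₁ R)  ≡⟨ sumList-map (outflow y) proj₁ R ⟩
          sumOf (outflow y) R                ≡⟨ ℚ.+-identityʳ _ ⟨
          sumOf (outflow y) R +ℚ 0ℚ          ≡⟨ conserved y ⟩
          sumOf (inflow y) R +ℚ 0ℚ           ≡⟨ ℚ.+-identityʳ _ ⟩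
          sumOf (inflow y) R                 ≡⟨ sumList-map (inflow y) proj₁ R ⟨
          sumList (inflow y) (map proj₁ R)   ∎
          where open ≡-Reasoning
        lift : HasPotential (map proj₁ R) ⊎ OddClosedWalk → (∃ λ p → ConsistentOn p [] []) ⊎ OddClosedWalk
        lift (inj₁ (p , consistent)) = inj₁ (p , All.map⁻ consistent , [] , [])
        lift (inj₂ odd) = inj₂ odd
      extend [] (b ∷ O) _ _ same-flow _ = ⊥-elim (ℚ.<-irrefl same-flow (sumList-pos (flow-pos ∘ proj₁) b O))
      extend (a ∷ I) [] _ _ same-flow _ = ⊥-elim (ℚ.<-irrefl (sym same-flow) (sumList-pos (flow-pos ∘ proj₁) a I))
      extend (a₀ ∷ I) (b₀ ∷ O) inside-I inside-O same-flow conserved = lift (recurse A′ inside′ circulation)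
        where
        I⁺ : List (Σ Arc Entering)
        I⁺ = a₀ ∷ I
        O⁺ : List (Σ Arc Leaving)
        O⁺ = b₀ ∷ O
        open Shortcuts (sumOf flow I⁺) (sumList-pos (flow-pos ∘ proj₁) a₀ I)
        A′ : List Arc
        A′ = map proj₁ R ++ shortcuts I⁺ O⁺
        inside′ : All (Within V′) A′
        inside′ = All.++⁺ avoiding-inside (All.tabulate shortcut-inside)
          where
          shortcut-inside : ∀ {s} → s ∈ shortcuts I⁺ O⁺ → Within V′ s
          shortcut-inside s∈ with ∈-cartesianProductWith⁻ shortcut I⁺ O⁺ s∈
          ... | (a , t≢z , _) , (b , _ , h≢z) , a∈ , b∈ , refl =
            shrink (proj₁ (All.lookup inside-I a∈)) t≢z , shrink (proj₂ (All.lookup inside-O b∈)) h≢z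
        circulation : IsCirculation A′
        circulation y = begin
          sumList (outflow y) A′
            ≡⟨ sumList-++ (outflow y) (map proj₁ R) _ ⟩
          sumList (outflow y) (map proj₁ R) +ℚ sumList (outflow y) (shortcuts I⁺ O⁺)
            ≡⟨ cong₂ _+ℚ_ (sumList-map (outflow y) proj₁ R) (outflow-shortcuts I⁺ O⁺ (sym same-flow) y) ⟩
          sumOf (outflow y) R +ℚ sumOf (outflow y) I⁺
            ≡⟨ conserved y ⟩
          sumOf (inflow y) R +ℚ sumOf (inflow y) O⁺
            ≡⟨ cong₂ _+ℚ_ (sumList-map (inflow y) proj₁ R) (inflow-shortcuts I⁺ O⁺ refl y) ⟨
          sumList (inflow y) (map proj₁ R) +ℚ sumList (inflow y) (shortcuts I⁺ O⁺)
            ≡⟨ sumList-++ (inflow y) (map proj₁ R) _ ⟨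
          sumList (inflow y) A′ ∎
          where open ≡-Reasoning
        lift : HasPotential A′ ⊎ OddClosedWalk → (∃ λ p → ConsistentOn p I⁺ O⁺) ⊎ OddClosedWalk
        lift (inj₂ odd) = inj₂ odd
        lift (inj₁ (p , consistent)) =
          inj₁ (extendAt p a₀
               , All.map (λ {r} → avoiding-consistent p _ r) (All.map⁻ (All.++⁻ˡ (map proj₁ R) consistent))
               , All.tabulate (λ {a} a∈ → entering-consistent p a₀ b₀ a (on-shortcut a∈ (here refl)) (on-shortcut (here refl) (here refl)))
               , All.tabulate (λ {b} b∈ → leaving-consistent p a₀ b (on-shortcut (here refl) b∈)))
          where
          on-shortcut : ∀ {a b} → a ∈ I⁺ → b ∈ O⁺ → ShortcutConsistent p a b
          on-shortcut a∈ b∈ = All.lookup (All.++⁻ʳ (map proj₁ R) consistent) (∈-cartesianProductWith⁺ shortcut a∈ b∈)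

    reduce : ∀ {V V′ : Fin n → Set} → (∀ {y} → V y → y ≢ z → V′ y) →
             ((A′ : List Arc) → All (Within V′) A′ → IsCirculation A′ → HasPotential A′ ⊎ OddClosedWalk) →
             (s : Classified) → AllClassified (Within V) s → (∀ y → sumClassified (outflow y) s ≡ sumClassified (inflow y) s) →
             HasPotentialOn s ⊎ OddClosedWalk
    reduce shrink recurse (classified R L I O) (inside-R , _ , inside-I , inside-O) balanced = byLoops (findOddLoop L)
      where
      open Balance R L I O balanced
      open Reduce shrink recurse R inside-R
      byLoops : OddClosedWalk ⊎ All (λ l → weight (route (proj₁ l)) ≡ false) L → HasPotentialOn (classified R L I O) ⊎ OddClosedWalk
      byLoops (inj₁ odd)  = inj₂ odd
      byLoops (inj₂ even) = Sum.map₁ withLoops (extend I O inside-I inside-O flow-entering≡leaving conserved)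
        where
        withLoops : (∃ λ p → ConsistentOn p I O) → HasPotentialOn (classified R L I O)
        withLoops (p , on-R , on-I , on-O) = p , on-R , All.map (λ {l} → even-loop-consistent p l) even , on-I , on-O

    eliminate : ∀ {V V′ : Fin n → Set} → (∀ {y} → V y → y ≢ z → V′ y) →
                ((A′ : List Arc) → All (Within V′) A′ → IsCirculation A′ → HasPotential A′ ⊎ OddClosedWalk) →
                (A : List Arc) → All (Within V) A → IsCirculation A → HasPotential A ⊎ OddClosedWalk
    eliminate shrink recurse A inside circulation =
      Sum.map₁ (λ (p , consistent) → p , all-classify⁻ A consistent)
               (reduce shrink recurse (classify A) (all-classify⁺ A inside) classified-balance)
      where
      classified-balance : ∀ y → sumClassified (outflow y) (classify A) ≡ sumClassified (inflow y) (classify A)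
      classified-balance y = trans (sym (sum-classify (outflow y) A)) (trans (circulation y) (sum-classify (inflow y) A))

  potentialOrOddClosedWalk : (A : List Arc) → IsCirculation A → HasPotential A ⊎ OddClosedWalk
  potentialOrOddClosedWalk A = go n ℕ.≤-refl A (All.tabulate (λ {a} _ → toℕ<n (tail a) , toℕ<n (head a)))
    where
    Below : ℕ → Fin n → Set
    Below k y = toℕ y ℕ.< k
    go : ∀ k → k ℕ.≤ n → (A : List Arc) → All (Within (Below k)) A → IsCirculation A → HasPotential A ⊎ OddClosedWalk
    go zero    _   []      _ _ = inj₁ ((λ _ → false) , [])
    go zero    _   (a ∷ _) ((() , _) ∷ _) _
    go (suc k) k<n = Eliminate.eliminate (fromℕ< k<n) below (go k (ℕ.<⇒≤ k<n))
      where
      below : ∀ {y} → Below (suc k) y → y ≢ fromℕ< k<n → Below k y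
      below {y} (s≤s y≤k) y≢z with ℕ.m≤n⇒m<n∨m≡n y≤k
      ... | inj₁ y<k = y<k
      ... | inj₂ y≡k = contradiction (toℕ-injective (trans y≡k (sym (toℕ-fromℕ< k<n)))) y≢z


  edges : ∀ {a b} → Walk a b → List Edge
  edges []      = []
  edges (e ∷ w) = e ∷ edges w

  sources : ∀ {a b} → Walk a b → List (Fin n)
  sources w = map src (edges w)

  weight≡xorList : ∀ {a b} (w : Walk a b) → weight w ≡ xorList (map label (edges w))
  weight≡xorList []      = refl
  weight≡xorList (e ∷ w) = cong (label e xor_) (weight≡xorList w)

  xorList-src-tgt : ∀ (g : Fin n → Bool) {a b} (w : Walk a b) →
                    xorList (map (g ∘ src) (edges w)) xor g b ≡ g a xor xorList (map (g ∘ tgt) (edges w))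
  xorList-src-tgt g []      = xor-comm false (g _)
  xorList-src-tgt g (e ∷ w) = begin
    (g (src e) xor xorList (map (g ∘ src) (edges w))) xor g _  ≡⟨ xor-assoc (g (src e)) _ _ ⟩
    g (src e) xor (xorList (map (g ∘ src) (edges w)) xor g _)  ≡⟨ cong (g (src e) xor_) (xorList-src-tgt g w) ⟩
    g (src e) xor (g (tgt e) xor xorList (map (g ∘ tgt) (edges w))) ∎
    where open ≡-Reasoning

  closed-src-tgt : ∀ (g : Fin n → Bool) {a} (c : Walk a a) → xorList (map (g ∘ src) (edges c)) ≡ xorList (map (g ∘ tgt) (edges c))
  closed-src-tgt g {a} c = begin
    xorList (map (g ∘ src) (edges c))                  ≡⟨ xor-cancelʳ _ (g a) ⟨
    (xorList (map (g ∘ src) (edges c)) xor g a) xor g a ≡⟨ cong (_xor g a) (xorList-src-tgt g c) ⟩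
    (g a xor xorList (map (g ∘ tgt) (edges c))) xor g a ≡⟨ cong (_xor g a) (xor-comm (g a) _) ⟩
    (xorList (map (g ∘ tgt) (edges c)) xor g a) xor g a ≡⟨ xor-cancelʳ _ (g a) ⟩
    xorList (map (g ∘ tgt) (edges c))                  ∎
    where open ≡-Reasoning

  steps : ∀ {a b} → Walk a b → ℕ
  steps []      = 0
  steps (e ∷ w) = suc (steps w)

  steps-++ : ∀ {a b c} (w : Walk a b) (w′ : Walk b c) → steps (w ++ʷ w′) ≡ steps w + steps w′
  steps-++ []      w′ = refl
  steps-++ (e ∷ w) w′ = cong suc (steps-++ w w′)

  locate : ∀ {a b} (w : Walk a b) y → y ∉ sources w ⊎ Σ (Walk a y) λ p → Σ (Walk y b) λ r → 1 ℕ.≤ steps r × w ≡ p ++ʷ r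
  locate []      y = inj₁ λ ()
  locate (e ∷ w) y with src e ≟ y
  ... | yes refl = inj₂ ([] , e ∷ w , s≤s z≤n , refl)
  ... | no src≢y with locate w y
  ...   | inj₁ y∉ = inj₁ λ { (here y≡src) → src≢y (sym y≡src) ; (there y∈) → y∉ y∈ }
  ...   | inj₂ (p , r , r≥1 , eq) = inj₂ (e ∷ p , r , r≥1 , cong (e ∷_) eq)

  Revisit : ∀ {a b} → Walk a b → Set
  Revisit {a} {b} w = ∃ λ y → Σ (Walk a y) λ p → Σ (Walk y y) λ q → Σ (Walk y b) λ r →
                        1 ℕ.≤ steps q × 1 ℕ.≤ steps r × w ≡ p ++ʷ (q ++ʷ r)

  revisit : ∀ {a b} (w : Walk a b) → Unique (sources w) ⊎ Revisit w
  revisit []      = inj₁ []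
  revisit (e ∷ w) with revisit w
  ... | inj₂ (y , p , q , r , q≥1 , r≥1 , eq) = inj₂ (y , e ∷ p , q , r , q≥1 , r≥1 , cong (e ∷_) eq)
  ... | inj₁ unique with locate w (src e)
  ...   | inj₁ fresh = inj₁ (¬Any⇒All¬ (sources w) fresh ∷ unique)
  ...   | inj₂ (p , r , r≥1 , eq) = inj₂ (src e , [] , e ∷ p , r , s≤s z≤n , r≥1 , cong (e ∷_) eq)

  SimpleOddCycle : Set
  SimpleOddCycle = ∃ λ a → Σ (Walk a a) λ c → Unique (sources c) × weight c ≡ true

  -- Split at a repeated source: the inner closed walk and the rest are both shorter, and one is odd.
  simplify : ∀ fuel {a} (c : Walk a a) → steps c ℕ.≤ fuel → weight c ≡ true → SimpleOddCycle
  simplify fuel c bound odd = byRevisit (revisit c)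
    where
    byRevisit : Unique (sources c) ⊎ Revisit c → SimpleOddCycle
    byRevisit (inj₁ unique) = _ , c , unique , odd
    byRevisit (inj₂ (y , p , q , r , q≥1 , r≥1 , refl)) = byParity fuel bound (weight q) refl
      where
      size : steps (p ++ʷ (q ++ʷ r)) ≡ steps p + (steps q + steps r)
      size = trans (steps-++ p (q ++ʷ r)) (cong (steps p +_) (steps-++ q r))
      parity : weight p xor (weight q xor weight r) ≡ true
      parity = trans (sym (trans (weight-++ p (q ++ʷ r)) (cong (weight p xor_) (weight-++ q r)))) odd
      q-shorter : steps q ℕ.< steps (p ++ʷ (q ++ʷ r))
      q-shorter = subst (steps q ℕ.<_) (sym size) (ℕ.<-≤-trans (ℕ.m<m+n (steps q) r≥1) (ℕ.m≤n+m _ (steps p)))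
      rp-shorter : steps (r ++ʷ p) ℕ.< steps (p ++ʷ (q ++ʷ r))
      rp-shorter = subst₂ ℕ._<_ (trans (ℕ.+-comm (steps p) (steps r)) (sym (steps-++ r p))) (sym size)
                          (ℕ.+-monoʳ-< (steps p) (ℕ.m<n+m (steps r) q≥1))
      byParity : ∀ fuel → steps (p ++ʷ (q ++ʷ r)) ℕ.≤ fuel → ∀ b → weight q ≡ b → SimpleOddCycle
      byParity zero bound _ _ = contradiction (ℕ.<-≤-trans q-shorter bound) λ ()
      byParity (suc fuel) bound true q-odd = simplify fuel q (ℕ.≤-pred (ℕ.<-≤-trans q-shorter bound)) q-odd
      byParity (suc fuel) bound false q-even =
        simplify fuel (r ++ʷ p) (ℕ.≤-pred (ℕ.<-≤-trans rp-shorter bound))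
                 (trans (weight-++ r p) (trans (xor-comm (weight r) (weight p)) (subst (λ b → weight p xor (b xor weight r) ≡ true) q-even parity)))

  simpleOddCycle : OddClosedWalk → SimpleOddCycle
  simpleOddCycle (a , .a , c , refl , odd) = simplify (steps c) c ℕ.≤-refl odd

  atSource : List Edge → Fin n → Maybe Edge
  atSource []       u = nothing
  atSource (e ∷ es) u with src e ≟ u
  ... | yes _ = just e
  ... | no _  = atSource es u

  atSource-just : ∀ es {u e} → atSource es u ≡ just e → src e ≡ u × e ∈ es
  atSource-just (e′ ∷ es) {u} eq with src e′ ≟ u
  atSource-just (e′ ∷ es) refl | yes src≡u = src≡u , here refl
  ... | no _ with atSource-just es eq
  ...   | src≡u , e∈ = src≡u , there e∈

  atSource-nothing : ∀ es {u} → atSource es u ≡ nothing → u ∉ map src es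
  atSource-nothing (e ∷ es) {u} eq u∈ with src e ≟ u | u∈
  ... | no src≢u | here u≡src = src≢u (sym u≡src)
  ... | no _     | there u∈′  = atSource-nothing es eq u∈′

  atSource-fresh : ∀ es {u} → u ∉ map src es → atSource es u ≡ nothing
  atSource-fresh []       u∉ = refl
  atSource-fresh (e ∷ es) {u} u∉ with src e ≟ u
  ... | yes src≡u = contradiction (here (sym src≡u)) u∉
  ... | no _      = atSource-fresh es (u∉ ∘ there)

  ⨁-atSource : ∀ (h : Edge → Bool) es → Unique (map src es) → ⨁ (λ u → maybe h false (atSource es u)) ≡ xorList (map h es)
  ⨁-atSource h []       _ = Xor.sum-replicate-zero n
  ⨁-atSource h (e ∷ es) (fresh ∷ unique) = begin
    ⨁ (λ u → maybe h false (atSource (e ∷ es) u))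
      ≡⟨ Xor.sum-cong-≗ split ⟩
    ⨁ (λ u → (⌊ u ≟ src e ⌋ ∧ h e) xor maybe h false (atSource es u))
      ≡⟨ Xor.∑-distrib-+ (λ u → ⌊ u ≟ src e ⌋ ∧ h e) (λ u → maybe h false (atSource es u)) ⟩
    ⨁ (λ u → ⌊ u ≟ src e ⌋ ∧ h e) xor ⨁ (λ u → maybe h false (atSource es u))
      ≡⟨ cong₂ _xor_ (⨁-pick (src e) (λ _ → h e)) (⨁-atSource h es unique) ⟩
    h e xor xorList (map h es) ∎
    where
    open ≡-Reasoning
    split : ∀ u → maybe h false (atSource (e ∷ es) u) ≡ (⌊ u ≟ src e ⌋ ∧ h e) xor maybe h false (atSource es u)
    split u with src e ≟ u
    ... | yes refl = trans (sym (xor-identityʳ (h e)))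
                           (cong₂ (λ b m → (b ∧ h e) xor maybe h false m) (sym (⌊⌋-true (src e ≟ src e) refl))
                                  (sym (atSource-fresh es (All¬⇒¬Any fresh))))
    ... | no src≢u = cong (λ b → (b ∧ h e) xor maybe h false (atSource es u)) (sym (⌊⌋-false (u ≟ src e) (src≢u ∘ sym)))

  targets : ∀ {a b} → Walk a b → List (Fin n)
  targets w = map tgt (edges w)

  targets-shift : ∀ {a b} (w : Walk a b) → a ∷ targets w ≡ sources w ∷ʳ b
  targets-shift []      = refl
  targets-shift (e ∷ w) = cong (src e ∷_) (targets-shift w)

  closed-targets : ∀ {a} (c : Walk a a) → Unique (sources c) →
                   Unique (targets c) × (∀ {t} → t ∈ targets c → t ∈ sources c)
  closed-targets []      _                  = [] , λ ()
  closed-targets (e ∷ w) (fresh ∷ unique) rewrite targets-shift w =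
    Unique.++⁺ unique ([] ∷ []) disjoint , rotate
    where
    disjoint : ∀ {t} → t ∈ sources w × t ∈ (src e ∷ []) → ⊥
    disjoint (t∈ , here refl) = All¬⇒¬Any fresh t∈
    rotate : ∀ {t} → t ∈ sources w ∷ʳ src e → t ∈ src e ∷ sources w
    rotate t∈ with ∈-++⁻ (sources w) t∈
    ... | inj₁ t∈w       = there t∈w
    ... | inj₂ (here eq) = here eq

  edgeArc : (e : Edge) (w : ℚ) → 0ℚ < w → Arc
  edgeArc e w pos = arc (src e) (tgt e) (e ∷ []) w pos

  consIfPositive : ∀ {w} → (0ℚ < w → Arc) → Dec (0ℚ < w) → List Arc → List Arc
  consIfPositive mk (yes pos) A = mk pos ∷ A
  consIfPositive mk (no _)    A = A

  supportArcs : ∀ {k} → (Fin k → Edge) → (Fin k → ℚ) → List Arc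
  supportArcs {zero}  edge x = []
  supportArcs {suc k} edge x = consIfPositive (edgeArc (edge zero) (x zero)) (0ℚ ℚ.<? x zero) (supportArcs (edge ∘ suc) (x ∘ suc))

  sumList-supportArcs : ∀ {k} (edge : Fin k → Edge) (x : Fin k → ℚ) → (∀ i → 0ℚ ≤ x i) →
                        (g : Arc → ℚ) (h : Edge → ℚ → ℚ) → (∀ e w pos → g (edgeArc e w pos) ≡ h e w) → (∀ e → h e 0ℚ ≡ 0ℚ) →
                        sumList g (supportArcs edge x) ≡ sumQ k (λ i → h (edge i) (x i))
  sumList-supportArcs {zero}  edge x x≥0 g h on-arc at-0 = refl
  sumList-supportArcs {suc k} edge x x≥0 g h on-arc at-0 = first (0ℚ ℚ.<? x zero)
    where
    rest : sumList g (supportArcs (edge ∘ suc) (x ∘ suc)) ≡ sumQ k (λ i → h (edge (suc i)) (x (suc i)))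
    rest = sumList-supportArcs (edge ∘ suc) (x ∘ suc) (x≥0 ∘ suc) g h on-arc at-0
    first : (d : Dec (0ℚ < x zero)) → sumList g (consIfPositive (edgeArc (edge zero) (x zero)) d (supportArcs (edge ∘ suc) (x ∘ suc))) ≡
                                      h (edge zero) (x zero) +ℚ sumQ k (λ i → h (edge (suc i)) (x (suc i)))
    first (yes pos) = cong₂ _+ℚ_ (on-arc (edge zero) (x zero) pos) rest
    first (no x≯0) = begin
      sumList g (supportArcs (edge ∘ suc) (x ∘ suc))            ≡⟨ rest ⟩
      sumQ k (λ i → h (edge (suc i)) (x (suc i)))               ≡⟨ ℚ.+-identityˡ _ ⟨
      0ℚ +ℚ sumQ k (λ i → h (edge (suc i)) (x (suc i)))         ≡⟨ cong (_+ℚ sumQ k (λ i → h (edge (suc i)) (x (suc i)))) (trans (sym (at-0 (edge zero))) (cong (h (edge zero)) (sym x≡0))) ⟩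
      h (edge zero) (x zero) +ℚ sumQ k (λ i → h (edge (suc i)) (x (suc i))) ∎
      where
      open ≡-Reasoning
      x≡0 : x zero ≡ 0ℚ
      x≡0 = ℚ.≤-antisym (ℚ.≮⇒≥ x≯0) (x≥0 zero)

  supportArcs-all : ∀ {k} (edge : Fin k → Edge) (x : Fin k → ℚ) {Q : Arc → Set} → All Q (supportArcs edge x) →
                    ∀ i → 0ℚ < x i → ∃ λ pos → Q (edgeArc (edge i) (x i) pos)
  supportArcs-all {suc k} edge x {Q} all i pos = split (0ℚ ℚ.<? x zero) all i pos
    where
    split : (d : Dec (0ℚ < x zero)) → All Q (consIfPositive (edgeArc (edge zero) (x zero)) d (supportArcs (edge ∘ suc) (x ∘ suc))) →
            ∀ i → 0ℚ < x i → ∃ λ pos → Q (edgeArc (edge i) (x i) pos)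
    split (yes pos₀) (q ∷ _)  zero    _   = pos₀ , q
    split (yes _)    (_ ∷ qs) (suc i) pos = supportArcs-all (edge ∘ suc) (x ∘ suc) qs i pos
    split (no x≯0)   _        zero    pos = contradiction pos x≯0
    split (no _)     qs       (suc i) pos = supportArcs-all (edge ∘ suc) (x ∘ suc) qs i pos

-- The exchange graph of an even perfect matching

module Exchange {n : ℕ} (G : BipGraph n) {x : Fin (m G) → ℚ} (fpm : IsFractionalPM G x) (P₀ : PerfectMatching G) where

  open PerfectMatching P₀

  mateOf : Fin (m G) → Fin n
  mateOf e = mate (vE G e)

  redAt : Fin n → Bool
  redAt u = isRed (col G (edgeAt u))

  -- Switching M₀ along e and the M₀-edge at the V-end of e changes the red parity by this label.
  exchangeLabel : Fin (m G) → Bool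
  exchangeLabel e = redAt (mateOf e) xor isRed (col G e)

  open Walks (uE G) mateOf exchangeLabel

  arcs : List Arc
  arcs = supportArcs (λ e → e) x

  arcs-circulation : IsCirculation arcs
  arcs-circulation y = begin
    sumList (outflow y) arcs                     ≡⟨ sumList-supportArcs (λ e → e) x x≥0 (outflow y) _ (λ _ _ _ → refl) (λ _ → if-vanish _ refl) ⟩
    sumOver G (incU G y) x                       ≡⟨ proj₁ fpm y ⟩
    1ℚ                                           ≡⟨ proj₁ (proj₂ fpm) (vE G (edgeAt y)) ⟨
    sumOver G (incV G (vE G (edgeAt y))) x       ≡⟨ sumQ-cong (m G) (λ e → cong (λ b → if b then x e else 0ℚ) (mate≟ e)) ⟨
    sumQ (m G) (λ e → if ⌊ mateOf e ≟ y ⌋ then x e else 0ℚ) ≡⟨ sumList-supportArcs (λ e → e) x x≥0 (inflow y) _ (λ _ _ _ → refl) (λ _ → if-vanish _ refl) ⟨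
    sumList (inflow y) arcs                      ∎
    where
    open ≡-Reasoning
    x≥0 : ∀ e → 0ℚ ≤ x e
    x≥0 = proj₂ (proj₂ fpm)
    mate≟ : ∀ e → ⌊ mateOf e ≟ y ⌋ ≡ ⌊ vE G e ≟ vE G (edgeAt y) ⌋
    mate≟ e = ⌊⌋-cong (mateOf e ≟ y) (vE G e ≟ vE G (edgeAt y))
                (λ mate≡y → trans (sym (vE-edgeAt-mate (vE G e))) (cong (vE G ∘ edgeAt) mate≡y))
                (λ vE≡ → trans (cong mate vE≡) (mate-vE-edgeAt y))

  module _ (inSupport : ∀ u → 0ℚ < x (edgeAt u)) (even : redParity ≡ false) where

    avoids-EL : ∀ P Q g r → P xor Q ≡ (g xor r) xor false → not (P xor ((Q xor not g) xor r)) ≡ false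
    avoids-EL P Q g r eq = trans (cong (λ P′ → not (P′ xor ((Q xor not g) xor r))) (xor-solveˡ {P} {Q} eq))
      (solve 3 (λ Q g r → con true :+ (((((g :+ r) :+ con false) :+ Q) :+ ((Q :+ (con true :+ g)) :+ r))) := con false) refl Q g r)
      where open xor-∧-Solver

    noPotential : (covers : ∀ LU LV → InLall n LU LV → 1ℚ ≤ sumOver G (inEL G LU LV) x) → ∀ p → ¬ All (Consistent p) arcs
    noPotential covers p consistent =
      ℚ.<-irrefl refl (ℚ.<-≤-trans (ℚ.positive⁻¹ 1ℚ) (ℚ.≤-trans (covers LU LV inLall) (ℚ.≤-reflexive uncovered)))
      where
      -- chosen so that every support edge on which p is consistent lies outside E_L
      LU LV : Fin n → Bool
      LU = p
      LV v = p (mate v) xor not (redAt (mate v))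
      avoided : ∀ e → 0ℚ < x e → inEL G LU LV e ≡ false
      avoided e pos = trans (inEL-xor G LU LV e)
        (avoids-EL (p (uE G e)) (p (mateOf e)) (redAt (mateOf e)) (isRed (col G e))
                          (proj₂ (supportArcs-all (λ e → e) x consistent e pos)))
      uncovered : sumOver G (inEL G LU LV) x ≡ 0ℚ
      uncovered = sumQ-zero (m G) term
        where
        term : ∀ e → (if inEL G LU LV e then x e else 0ℚ) ≡ 0ℚ
        term e = byPositivity (0ℚ ℚ.<? x e)
          where
          byPositivity : Dec (0ℚ < x e) → (if inEL G LU LV e then x e else 0ℚ) ≡ 0ℚ
          byPositivity (yes pos) = cong (λ b → if b then x e else 0ℚ) (avoided e pos)
          byPositivity (no x≯0)  = if-vanish (inEL G LU LV e) (ℚ.≤-antisym (ℚ.≮⇒≥ x≯0) (proj₂ (proj₂ fpm) e))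
      inLall : InLall n LU LV
      inLall = ⇒InLall G LU LV (sym (trans (xor-solveˡ {isOdd n} {(⨁ LU xor ⨁ LV) xor false} balanced) (xor-identityʳ (⨁ LU xor ⨁ LV))))
        where
        balanced : isOdd n xor ((⨁ LU xor ⨁ LV) xor false) ≡ false
        balanced = begin
          isOdd n xor ((⨁ LU xor ⨁ LV) xor false)       ≡⟨ cong (λ b → isOdd n xor ((⨁ LU xor ⨁ LV) xor b)) even ⟨
          isOdd n xor ((⨁ LU xor ⨁ LV) xor redParity)   ≡⟨ ⨁-inEL-edgeAt G P₀ LU LV ⟨
          ⨁ (λ u → inEL G LU LV (edgeAt u))             ≡⟨ Xor.sum-cong-≗ (λ u → avoided (edgeAt u) (inSupport u)) ⟩
          ⨁ {n} (λ _ → false)                           ≡⟨ Xor.sum-replicate-zero n ⟩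
          false                                          ∎
          where open ≡-Reasoning


    module Switch {a} (c : Walk a a) (unique : Unique (sources c)) (odd : weight c ≡ true) where

      switchedAt : Fin n → Fin (m G)
      switchedAt u = maybe′ (λ e → e) (edgeAt u) (atSource (edges c) u)

      uE-switchedAt : ∀ u → uE G (switchedAt u) ≡ u
      uE-switchedAt u = byLookup (atSource (edges c) u) refl
        where
        byLookup : ∀ r → atSource (edges c) u ≡ r → uE G (maybe′ (λ e → e) (edgeAt u) r) ≡ u
        byLookup (just e) found = proj₁ (atSource-just (edges c) found)
        byLookup nothing  _     = uE-edgeAt u

      switched-injective : ∀ {u u′} → vE G (switchedAt u) ≡ vE G (switchedAt u′) → u ≡ u′
      switched-injective {u} {u′} = byLookup (atSource (edges c) u) (atSource (edges c) u′) refl refl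
        where
        targets-unique : Unique (targets c)
        targets-unique = proj₁ (closed-targets c unique)
        targets⊆sources : ∀ {t} → t ∈ targets c → t ∈ sources c
        targets⊆sources = proj₂ (closed-targets c unique)
        onCycle : ∀ {e w} → atSource (edges c) w ≡ just e → ∀ w′ → vE G e ≡ vE G (edgeAt w′) → atSource (edges c) w′ ≡ nothing → ⊥
        onCycle {e} found w′ same fresh =
          atSource-nothing (edges c) fresh (targets⊆sources (subst (_∈ targets c) (trans (cong mate same) (mate-vE-edgeAt w′))
                                                                    (∈-map⁺ mateOf (proj₂ (atSource-just (edges c) found)))))
        byLookup : ∀ r r′ → atSource (edges c) u ≡ r → atSource (edges c) u′ ≡ r′ →
                   vE G (maybe′ (λ e → e) (edgeAt u) r) ≡ vE G (maybe′ (λ e → e) (edgeAt u′) r′) → u ≡ u′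
        byLookup (just e) (just e′) found found′ same = begin
          u        ≡⟨ proj₁ (atSource-just (edges c) found) ⟨
          uE G e   ≡⟨ cong (uE G) (unique-map-injective mateOf targets-unique (proj₂ (atSource-just (edges c) found))
                                                          (proj₂ (atSource-just (edges c) found′)) (cong mate same)) ⟩
          uE G e′  ≡⟨ proj₁ (atSource-just (edges c) found′) ⟩
          u′       ∎
          where open ≡-Reasoning
        byLookup (just e) nothing  found fresh′ same = ⊥-elim (onCycle found u′ same fresh′)
        byLookup nothing (just e′) fresh found′ same = ⊥-elim (onCycle found′ u (sym same) fresh)
        byLookup nothing nothing   _     _      same = vE-edgeAt-injective same

      switched : PerfectMatching G
      switched = record { edgeAt = switchedAt ; uE-edgeAt = uE-switchedAt ; vE-edgeAt-injective = switched-injective }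

      switched-odd : PerfectMatching.redParity switched ≡ true
      switched-odd = begin
        ⨁ (λ u → isRed (col G (switchedAt u)))
          ≡⟨ Xor.sum-cong-≗ (λ u → byLookup u (atSource (edges c) u) refl) ⟩
        ⨁ (λ u → redAt u xor maybe flip false (atSource (edges c) u))
          ≡⟨ Xor.∑-distrib-+ redAt (λ u → maybe flip false (atSource (edges c) u)) ⟩
        redParity xor ⨁ (λ u → maybe flip false (atSource (edges c) u))
          ≡⟨ cong₂ _xor_ even (⨁-atSource flip (edges c) unique) ⟩
        xorList (map flip (edges c))
          ≡⟨ xorList-map-xor (redAt ∘ uE G) (isRed ∘ col G) (edges c) ⟩
        xorList (map (redAt ∘ uE G) (edges c)) xor xorList (map (isRed ∘ col G) (edges c))
          ≡⟨ cong (_xor xorList (map (isRed ∘ col G) (edges c))) (closed-src-tgt redAt c) ⟩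
        xorList (map (redAt ∘ mateOf) (edges c)) xor xorList (map (isRed ∘ col G) (edges c))
          ≡⟨ xorList-map-xor (redAt ∘ mateOf) (isRed ∘ col G) (edges c) ⟨
        xorList (map exchangeLabel (edges c))
          ≡⟨ weight≡xorList c ⟨
        weight c
          ≡⟨ odd ⟩
        true ∎
        where
        open ≡-Reasoning
        flip : Fin (m G) → Bool
        flip e = redAt (uE G e) xor isRed (col G e)
        byLookup : ∀ u r → atSource (edges c) u ≡ r → isRed (col G (maybe′ (λ e → e) (edgeAt u) r)) ≡ redAt u xor maybe flip false r
        byLookup u (just e) found rewrite sym (proj₁ (atSource-just (edges c) found)) = sym (xor-cancelˡ (redAt (uE G e)) (isRed (col G e)))
        byLookup u nothing  _     = sym (xor-identityʳ (redAt u))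

    switchToOdd : (∀ LU LV → InLall n LU LV → 1ℚ ≤ sumOver G (inEL G LU LV) x) → HasOddRedPM G
    switchToOdd covers = fromAlternative (potentialOrOddClosedWalk arcs arcs-circulation)
      where
      fromAlternative : HasPotential arcs ⊎ OddClosedWalk → HasOddRedPM G
      fromAlternative (inj₁ (p , consistent)) = ⊥-elim (noPotential covers p consistent)
      fromAlternative (inj₂ oddWalk) with simpleOddCycle oddWalk
      ... | _ , c , unique , odd = hasOddRedPM G (Switch.switched c unique odd) (Switch.switched-odd c unique odd)

feasible⇒oddRedPM : ∀ {n} (G : BipGraph n) → Feasible G → HasOddRedPM G
feasible⇒oddRedPM G (x , degU , degV , covers , x≥0) = fromMatching (fractionalPM⇒PM G fpm)
  where
  fpm : IsFractionalPM G x
  fpm = degU , degV , x≥0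
  fromMatching : PerfectMatchingWithin G x → HasOddRedPM G
  fromMatching (P₀ , inSupport) = byParity (PerfectMatching.redParity P₀) refl
    where
    byParity : ∀ b → PerfectMatching.redParity P₀ ≡ b → HasOddRedPM G
    byParity true  odd  = hasOddRedPM G P₀ odd
    byParity false even = Exchange.switchToOdd G fpm P₀ inSupport even covers

theorem5p1 : (n : ℕ) (G : BipGraph n) → (Feasible G → HasOddRedPM G) × (HasOddRedPM G → Feasible G)
theorem5p1 n G = feasible⇒oddRedPM G , oddRedPM⇒feasible G
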